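{- Let $v,k,t,\lambda$ be integers with $t\ge 1$, let $A_1$ be the adjacency matrix of a strongly regular digraph with parameter set $(v,k,t,\lambda,t)$, and put $s=t-\lambda$. Suppose there exist $0$-$1$ matrices $B_1$ of size $v\times 4t$ and $C_1$ of size $4t\times v$ satisfying $$B_1C_1=tJ_v,\quad B_1P_1=tJ_{v,4t},\quad P_1C_1=tJ_{4t,v},\quad A_1B_1+sB_1=tJ_{v,4t},\quad C_1A_1+sC_1=tJ_{4t,v},\quad C_1B_1+sP_1=tJ_{4t},$$ $$B_1J_{4t}=2tJ_{v,4t},\quad J_vB_1=kJ_{v,4t},\quad C_1J_v=kJ_{4t,v},\quad J_{4t}C_1=2tJ_{4t,v},$$ together with the blockiness conditions: (i) if any row of $B_1$ is split into its first $2t$ and last $2t$ entries, exactly one of these two blocks consists entirely of ones and the other entirely of zeros; (ii) if any column of $C_1$ is split into its first $2t$ and last $2t$ entries, each of these two blocks contains exactly $t$ ones. Define for $n\ge 2$ $$B_n=\begin{pmatrix} K_2\otimes B_{n-1}\otimes J_{1,2}\\ I_2\otimes P_{n-1}\otimes J_{1,2}\end{pmatrix},\qquad C_n=\begin{pmatrix} J_{2^n,1}\otimes I_2\otimes \alpha_{2^{n-1}}(C_{n-1}) & J_{2^n,1}\otimes I_2\otimes \alpha_{2^{n-1}}(P_{n-1})\end{pmatrix},$$ and for $n\ge 1$ $$A_{n+1}=\begin{pmatrix} A_n & 0 & B_n & 0\\ 0 & A_n & 0 & B_n\\ 0 & C_n & 0 & P_n\\ C_n & 0 & P_n & 0\end{pmatrix}=\begin{pmatrix}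 I_2\otimes A_n & I_2\otimes B_n\\ K_2\otimes C_n & K_2\otimes P_n\end{pmatrix}.$$ Then for every $n\ge 1$, $A_n$ is the adjacency matrix of a strongly regular digraph with parameter set $\bigl((v+(2^{n+1}-4)t)2^{n-1},\ k+(2^n-2)t,\ t,\ \lambda,\ t\bigr)$.
   Context: Digraphs have no loops and no multiple edges in the same direction; the adjacency matrix $A$ has $A(i,j)=1$ if there is an edge from vertex $i$ to vertex $j$ and $0$ otherwise. A strongly regular digraph with parameter set $(v,k,t,\lambda,\mu)$ is a digraph on $v$ vertices whose adjacency matrix $A$ satisfies $A^2=tI_v+\lambda A+\mu(J_v-I_v-A)$ and $AJ_v=J_vA=kJ_v$. Notation: $I_m$ is the identity matrix of order $m$; $J_m$ is the all-ones square matrix of order $m$; $J_{m,l}$ is the all-ones $m\times l$ matrix; $K_m$ is the $m\times m$ exchange matrix with $K_m(i,j)=1$ if $i+j=m+1$ and $0$ otherwise; $\otimes$ is the Kronecker product. For $n\ge1$, $P_n=J_{2^n,1}\otimes K_{2^n}\otimes J_{t,t\cdot 2^n}$ (a square matrix of order $t\cdot 4^n$). For an $m\times l$ matrix $X$ and $s'$ dividing $m$, $\alpha_{s'}(X)$ denotes the matrix formed by the first $m/s'$ rows of $X$. Block matrices are written in the usual block form, with $0$ denoting zero blocks of appropriate size. -}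

module Defs where

open import Data.Nat as ℕ using (ℕ; zero; suc; _^_; _∸_; _<?_; NonZero)
open import Data.Nat.Properties using (m^n≢0)
open import Data.Nat.DivMod using (_/_; m/n≤m; m*n/n≡m)
open import Data.Nat.Tactic.RingSolver using (solve-∀)
open import Data.Integer as ℤ using (ℤ; +_; _+_; _*_; _-_; -_)
open import Data.Fin as Fin using (Fin; toℕ; splitAt; remQuot; inject≤; cast)
open import Data.Product using (_×_; _,_; proj₁; proj₂)
open import Data.Sum using (_⊎_; inj₁; inj₂)
open import Relation.Nullary.Decidable using (⌊_⌋)
open import Data.Bool using (Bool; true; false; _∧_; not; if_then_else_)
open import Relation.Binary.PropositionalEquality using (_≡_; refl; sym; trans; cong)

Mat : ℕ → ℕ → Set
Mat m n = Fin m → Fin n → ℤ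

sumF : ∀ {n} → (Fin n → ℤ) → ℤ
sumF {zero}  f = + 0
sumF {suc n} f = f Fin.zero + sumF (λ i → f (Fin.suc i))

_⊕_ : ∀ {m n} → Mat m n → Mat m n → Mat m n
(X ⊕ Y) i j = X i j + Y i j
infixl 6 _⊕_

_⊖_ : ∀ {m n} → Mat m n → Mat m n → Mat m n
(X ⊖ Y) i j = X i j - Y i j
infixl 6 _⊖_

_·_ : ∀ {m n} → ℤ → Mat m n → Mat m n
(c · X) i j = c * X i j
infixr 7 _·_

_⊛_ : ∀ {m n p} → Mat m n → Mat n p → Mat m p
(X ⊛ Y) i k = sumF (λ j → X i j * Y j k)
infixl 8 _⊛_

_≋_ : ∀ {m n} → Mat m n → Mat m n → Set
X ≋ Y = ∀ i j → X i j ≡ Y i j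
infix 4 _≋_

J : (m l : ℕ) → Mat m l
J m l i j = + 1

I : (m : ℕ) → Mat m m
I m i j = if ⌊ toℕ i ℕ.≟ toℕ j ⌋ then + 1 else + 0

-- K_m: exchange matrix, K(i,j) = 1 iff i + j = m + 1 (1-based), i.e. i + j = m - 1 (0-based)
K : (m : ℕ) → Mat m m
K m i j = if ⌊ toℕ i ℕ.+ toℕ j ℕ.≟ m ∸ 1 ⌋ then + 1 else + 0

-- Kronecker product (row-major block structure, via Fin.remQuot)
_⊗_ : ∀ {m n p q} → Mat m n → Mat p q → Mat (m ℕ.* p) (n ℕ.* q)
_⊗_ {m} {n} {p} {q} X Y i j =
  X (proj₁ (remQuot {m} p i)) (proj₁ (remQuot {n} q j))
  * Y (proj₂ (remQuot {m} p i)) (proj₂ (remQuot {n} q j))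
infixl 7 _⊗_

hcat : ∀ {m l₁ l₂} → Mat m l₁ → Mat m l₂ → Mat m (l₁ ℕ.+ l₂)
hcat {l₁ = l₁} X Y i j with splitAt l₁ j
... | inj₁ j₁ = X i j₁
... | inj₂ j₂ = Y i j₂

vcat : ∀ {m₁ m₂ l} → Mat m₁ l → Mat m₂ l → Mat (m₁ ℕ.+ m₂) l
vcat {m₁} X Y i j with splitAt m₁ i
... | inj₁ i₁ = X i₁ j
... | inj₂ i₂ = Y i₂ j

block : ∀ {a b c d} → Mat a c → Mat a d → Mat b c → Mat b d → Mat (a ℕ.+ b) (c ℕ.+ d)
block X Y Z W = vcat (hcat X Y) (hcat Z W)

castM : ∀ {m m' n n'} → m ≡ m' → n ≡ n' → Mat m n → Mat m' n'
castM p q X i j = X (cast (sym p) i) (cast (sym q) j)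

2^nz : ∀ m → NonZero (2 ^ m)
2^nz m = m^n≢0 2 m

-- α_{s'}(X): the first m/s' rows of an m × l matrix X
α : ∀ {m l} (s' : ℕ) .{{_ : NonZero s'}} → Mat m l → Mat (m / s') l
α {m} s' X i j = X (inject≤ i (m/n≤m m s')) j

ZeroOne : ∀ {m n} → Mat m n → Set
ZeroOne X = ∀ i j → (X i j ≡ + 0) ⊎ (X i j ≡ + 1)

IsSRD : ∀ {m} → Mat m m → (v : ℕ) (k t lam mu : ℤ) → Set
IsSRD {m} A v k t lam mu =
  (m ≡ v)
  × ZeroOne A
  × (∀ i → A i i ≡ + 0)
  × (A ⊛ A ≋ t · I m ⊕ lam · A ⊕ mu · (J m m ⊖ I m ⊖ A))
  × (A ⊛ J m m ≋ k · J m m)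
  × (J m m ⊛ A ≋ k · J m m)

dP : ℕ → ℕ → ℕ
dP t n = (2 ^ n ℕ.* 2 ^ n) ℕ.* t

private
  eqP : ∀ t n → (1 ℕ.* 2 ^ n) ℕ.* (t ℕ.* 2 ^ n) ≡ dP t n
  eqP t n = lem (2 ^ n) t
    where lem : ∀ x y → (1 ℕ.* x) ℕ.* (y ℕ.* x) ≡ (x ℕ.* x) ℕ.* y
          lem = solve-∀

PP : (t n : ℕ) → Mat (dP t n) (dP t n)
PP t n = castM refl (eqP t n) (J (2 ^ n) 1 ⊗ K (2 ^ n) ⊗ J t (t ℕ.* 2 ^ n))

RowBlocky : ∀ {v} (t : ℕ) → Mat v (4 ℕ.* t) → Set
RowBlocky t X = ∀ i →
    ((∀ j → toℕ j ℕ.< 2 ℕ.* t → X i j ≡ + 1) × (∀ j → 2 ℕ.* t ℕ.≤ toℕ j → X i j ≡ + 0))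
  ⊎ ((∀ j → toℕ j ℕ.< 2 ℕ.* t → X i j ≡ + 0) × (∀ j → 2 ℕ.* t ℕ.≤ toℕ j → X i j ≡ + 1))

count : ∀ {m} → (Fin m → Bool) → ℕ
count {zero} p = 0
count {suc m} p = (if p Fin.zero then 1 else 0) ℕ.+ count (λ i → p (Fin.suc i))

ColBalanced : ∀ {v} (t : ℕ) → Mat (4 ℕ.* t) v → Set
ColBalanced t X = ∀ j →
    (count (λ i → ⌊ toℕ i <? 2 ℕ.* t ⌋ ∧ ⌊ X i j ℤ.≟ + 1 ⌋) ≡ t)
  × (count (λ i → not ⌊ toℕ i <? 2 ℕ.* t ⌋ ∧ ⌊ X i j ℤ.≟ + 1 ⌋) ≡ t)

-- The recursive construction (index n ≥ 1; the n = 0 entries are unused junk)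

module Construction (v t : ℕ) (A₁ : Mat v v) (B₁ : Mat v (4 ℕ.* t)) (C₁ : Mat (4 ℕ.* t) v) where

  d : ℕ → ℕ
  d = dP t

  P : (n : ℕ) → Mat (d n) (d n)
  P = PP t

  a : ℕ → ℕ
  a zero = 0
  a (suc zero) = v
  a (suc (suc m)) = 2 ℕ.* a (suc m) ℕ.+ 2 ℕ.* d (suc m)

  private
    eqBr : ∀ m → (2 ℕ.* a (suc m)) ℕ.* 1 ℕ.+ (2 ℕ.* d (suc m)) ℕ.* 1 ≡ a (suc (suc m))
    eqBr m = lem (a (suc m)) (d (suc m))
      where lem : ∀ x y → (2 ℕ.* x) ℕ.* 1 ℕ.+ (2 ℕ.* y) ℕ.* 1 ≡ 2 ℕ.* x ℕ.+ 2 ℕ.* y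
            lem = solve-∀

    eqBc : ∀ m → (2 ℕ.* d (suc m)) ℕ.* 2 ≡ d (suc (suc m))
    eqBc m = lem (2 ^ m) t
      where lem : ∀ x y → (2 ℕ.* (((2 ℕ.* x) ℕ.* (2 ℕ.* x)) ℕ.* y)) ℕ.* 2
                          ≡ ((2 ℕ.* (2 ℕ.* x)) ℕ.* (2 ℕ.* (2 ℕ.* x))) ℕ.* y
            lem = solve-∀

    eqCc : ∀ m → (1 ℕ.* 2) ℕ.* a (suc m) ℕ.+ (1 ℕ.* 2) ℕ.* d (suc m) ≡ a (suc (suc m))
    eqCc m = lem (a (suc m)) (d (suc m))
      where lem : ∀ x y → (1 ℕ.* 2) ℕ.* x ℕ.+ (1 ℕ.* 2) ℕ.* y ≡ 2 ℕ.* x ℕ.+ 2 ℕ.* y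
            lem = solve-∀

    eqCr : ∀ m → (2 ^ suc (suc m) ℕ.* 2) ℕ.* (_/_ (d (suc m)) (2 ^ suc m) {{2^nz (suc m)}}) ≡ d (suc (suc m))
    eqCr m = trans (cong (λ z → (2 ^ suc (suc m) ℕ.* 2) ℕ.* z) q) (lem2 (2 ^ m) t)
      where
        lem1 : ∀ x y → ((2 ℕ.* x) ℕ.* (2 ℕ.* x)) ℕ.* y ≡ (2 ℕ.* x ℕ.* y) ℕ.* (2 ℕ.* x)
        lem1 = solve-∀
        lem2 : ∀ x y → ((2 ℕ.* (2 ℕ.* x)) ℕ.* 2) ℕ.* (2 ℕ.* x ℕ.* y)
                       ≡ ((2 ℕ.* (2 ℕ.* x)) ℕ.* (2 ℕ.* (2 ℕ.* x))) ℕ.* y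
        lem2 = solve-∀
        q : _/_ (d (suc m)) (2 ^ suc m) {{2^nz (suc m)}} ≡ 2 ℕ.* 2 ^ m ℕ.* t
        q = trans (cong (λ z → _/_ z (2 ^ suc m) {{2^nz (suc m)}}) (lem1 (2 ^ m) t))
                  (m*n/n≡m (2 ℕ.* 2 ^ m ℕ.* t) (2 ^ suc m) {{2^nz (suc m)}})

  B : (n : ℕ) → Mat (a n) (d n)
  B zero = λ ()
  B (suc zero) = B₁
  B (suc (suc m)) = castM (eqBr m) (eqBc m)
    (vcat (K 2 ⊗ B (suc m) ⊗ J 1 2)
          (I 2 ⊗ P (suc m) ⊗ J 1 2))

  C : (n : ℕ) → Mat (d n) (a n)
  C zero = λ _ ()
  C (suc zero) = C₁
  C (suc (suc m)) = castM (eqCr m) (eqCc m)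
    (hcat (J (2 ^ suc (suc m)) 1 ⊗ I 2 ⊗ α (2 ^ suc m) {{2^nz (suc m)}} (C (suc m)))
          (J (2 ^ suc (suc m)) 1 ⊗ I 2 ⊗ α (2 ^ suc m) {{2^nz (suc m)}} (P (suc m))))

  A : (n : ℕ) → Mat (a n) (a n)
  A zero = λ ()
  A (suc zero) = A₁
  A (suc (suc m)) =
    block (I 2 ⊗ A (suc m)) (I 2 ⊗ B (suc m))
          (K 2 ⊗ C (suc m)) (K 2 ⊗ P (suc m))

-- Write s = t − λ; the SRD identity for A with μ = t reads A² + sA = tJ.  Besides it and the
-- row and column sums, A_n, B_n, C_n inherit from A₁, B₁, C₁ the identities AB + sB = tJ,
-- CA + sC = tJ, CB + sP = tJ and a generalised blockiness: every row of B_n is the indicator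
-- of one of 2ⁿ consecutive blocks of length 2ⁿt, and every such block of a column of C_n
-- contains t ones.  P_n has the same two properties, hence BC = BP = PC = PP = tJ.
-- In the inductive step every row of A_{n+1} or C_{n+1} has the form (e_p ⊗ x | e_p ⊗ x′) and
-- every column of A_{n+1} or B_{n+1} the form (e_q ⊗ y ; e_{1−q} ⊗ y′), where x, x′ (y, y′)
-- are rows (columns) of A_n, B_n, C_n, P_n.  Such a product is δ_pq x·y + δ_{1−p,q} x′·y′, so
-- each identity at level n + 1 follows from one identity at level n and one product equal
-- to tJ.

module Submission where

open import Defs
open import Data.Nat as ℕ using (ℕ; _≤_; _^_; _∸_)
open import Data.Integer using (ℤ; +_; _+_; _-_)
open import Data.Nat using (zero; suc; _<_; _<?_; z≤n; s≤s; NonZero)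
import Data.Nat.Properties as ℕP
open import Data.Nat.DivMod using (_/_; _%_; m≡m%n+[m/n]*n; m%n<n; m<n*o⇒m/o<n; m/n≤m; m*n/n≡m)
open import Data.Nat.Tactic.RingSolver using (solve-∀)
open import Data.Integer as ℤ using (_*_)
import Data.Integer.Properties as ℤP
import Data.Integer.Tactic.RingSolver as ℤSolver
open import Algebra.Properties.CommutativeSemigroup ℤP.*-commutativeSemigroup using (interchange)
open import Data.Fin as Fin using (Fin; toℕ; fromℕ<; combine; _↑ˡ_; _↑ʳ_)
import Data.Fin.Properties as FinP
open import Data.Product using (Σ-syntax; _×_; _,_; proj₁; proj₂)
open import Data.Sum using (_⊎_; inj₁; inj₂)
open import Data.Bool using (Bool; true; false; _∧_; not; if_then_else_)
open import Data.Empty using (⊥-elim)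
open import Relation.Nullary using (yes; no; ¬_)
open import Relation.Nullary.Decidable using (⌊_⌋; isYes≗does; dec-true; dec-false)
open import Relation.Binary.PropositionalEquality
  using (_≡_; refl; sym; trans; cong; cong₂; subst; subst₂; module ≡-Reasoning)

-- Finite sums over initial segments of ℕ

∑< : ℕ → (ℕ → ℤ) → ℤ
∑< zero    f = + 0
∑< (suc n) f = f 0 + ∑< n (λ j → f (suc j))

infix 5 ∑<
syntax ∑< n (λ j → e) = ∑[ j < n ] e

∑-cong : ∀ n {f g : ℕ → ℤ} → (∀ j → j < n → f j ≡ g j) → ∑< n f ≡ ∑< n g
∑-cong zero    e = refl
∑-cong (suc n) e = cong₂ _+_ (e 0 (s≤s z≤n)) (∑-cong n (λ j j<n → e (suc j) (s≤s j<n)))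

∑-zero : ∀ n {f : ℕ → ℤ} → (∀ j → j < n → f j ≡ + 0) → ∑< n f ≡ + 0
∑-zero zero    e = refl
∑-zero (suc n) e = cong₂ _+_ (e 0 (s≤s z≤n)) (∑-zero n (λ j j<n → e (suc j) (s≤s j<n)))

∑-const : ∀ n (c : ℤ) → ∑[ _ < n ] c ≡ + n * c
∑-const zero    c = sym (ℤP.*-zeroˡ c)
∑-const (suc n) c = begin
  c + (∑[ _ < n ] c)  ≡⟨ cong (_+_ c) (∑-const n c) ⟩
  c + + n * c         ≡⟨ cong (_+ + n * c) (sym (ℤP.*-identityˡ c)) ⟩
  + 1 * c + + n * c   ≡⟨ sym (ℤP.*-distribʳ-+ c (+ 1) (+ n)) ⟩
  + suc n * c         ∎
  where
    open ≡-Reasoning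

∑-distribˡ : ∀ n (c : ℤ) (f : ℕ → ℤ) → ∑[ j < n ] c * f j ≡ c * ∑< n f
∑-distribˡ zero    c f = sym (ℤP.*-zeroʳ c)
∑-distribˡ (suc n) c f =
  trans (cong (_+_ (c * f 0)) (∑-distribˡ n c _)) (sym (ℤP.*-distribˡ-+ c (f 0) _))

∑-distribʳ : ∀ n (c : ℤ) (f : ℕ → ℤ) → ∑[ j < n ] f j * c ≡ ∑< n f * c
∑-distribʳ zero    c f = sym (ℤP.*-zeroˡ c)
∑-distribʳ (suc n) c f =
  trans (cong (_+_ (f 0 * c)) (∑-distribʳ n c _)) (sym (ℤP.*-distribʳ-+ c (f 0) _))

∑-+ : ∀ m n (f : ℕ → ℤ) → ∑< (m ℕ.+ n) f ≡ ∑< m f + (∑[ j < n ] f (m ℕ.+ j))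
∑-+ zero    n f = sym (ℤP.+-identityˡ _)
∑-+ (suc m) n f =
  trans (cong (_+_ (f 0)) (∑-+ m n (λ j → f (suc j)))) (sym (ℤP.+-assoc (f 0) _ _))

∑-* : ∀ m n (f : ℕ → ℤ) → ∑< (m ℕ.* n) f ≡ ∑[ x < m ] ∑[ y < n ] f (x ℕ.* n ℕ.+ y)
∑-* zero    n f = refl
∑-* (suc m) n f = begin
  ∑< (n ℕ.+ m ℕ.* n) f
    ≡⟨ ∑-+ n (m ℕ.* n) f ⟩
  ∑< n f + (∑[ j < m ℕ.* n ] f (n ℕ.+ j))
    ≡⟨ cong (_+_ (∑< n f)) (∑-* m n (λ j → f (n ℕ.+ j))) ⟩
  ∑< n f + (∑[ x < m ] ∑[ y < n ] f (n ℕ.+ (x ℕ.* n ℕ.+ y)))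
    ≡⟨ cong (_+_ (∑< n f)) (∑-cong m (λ x _ → ∑-cong n (λ y _ →
         cong f (sym (ℕP.+-assoc n (x ℕ.* n) y))))) ⟩
  ∑< n f + (∑[ x < m ] ∑[ y < n ] f (suc x ℕ.* n ℕ.+ y))
    ∎
  where
    open ≡-Reasoning

∑-⊗ : ∀ m n {f : ℕ → ℤ} (c z : ℕ → ℤ) →
      (∀ x y → x < m → y < n → f (x ℕ.* n ℕ.+ y) ≡ c x * z y) →
      ∑< (m ℕ.* n) f ≡ ∑< m c * ∑< n z
∑-⊗ m n {f} c z hf = begin
  ∑< (m ℕ.* n) f                             ≡⟨ ∑-* m n f ⟩
  ∑[ x < m ] ∑[ y < n ] f (x ℕ.* n ℕ.+ y)    ≡⟨ ∑-cong m (λ x x< → ∑-cong n (λ y y< → hf x y x< y<)) ⟩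
  ∑[ x < m ] ∑[ y < n ] c x * z y            ≡⟨ ∑-cong m (λ x _ → ∑-distribˡ n (c x) z) ⟩
  ∑[ x < m ] c x * ∑< n z                    ≡⟨ ∑-distribʳ m (∑< n z) c ⟩
  ∑< m c * ∑< n z                            ∎
  where
    open ≡-Reasoning

⌊<?⌋-true : ∀ {l m} → l < m → ⌊ l <? m ⌋ ≡ true
⌊<?⌋-true {l} {m} l<m = trans (isYes≗does (l <? m)) (dec-true (l <? m) l<m)

⌊<?⌋-false : ∀ {l m} → m ≤ l → ⌊ l <? m ⌋ ≡ false
⌊<?⌋-false {l} {m} m≤l = trans (isYes≗does (l <? m)) (dec-false (l <? m) (ℕP.≤⇒≯ m≤l))

∑-below : ∀ m n (f : ℕ → ℤ) → ∑[ l < m ℕ.+ n ] (if ⌊ l <? m ⌋ then f l else + 0) ≡ ∑< m f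
∑-below m n f = begin
  ∑[ l < m ℕ.+ n ] (if ⌊ l <? m ⌋ then f l else + 0)
    ≡⟨ ∑-+ m n _ ⟩
  (∑[ l < m ] (if ⌊ l <? m ⌋ then f l else + 0))
    + (∑[ l < n ] (if ⌊ m ℕ.+ l <? m ⌋ then f (m ℕ.+ l) else + 0))
    ≡⟨ cong₂ _+_ (∑-cong m (λ l l< → cong (λ b → if b then f l else + 0) (⌊<?⌋-true l<)))
                 (∑-zero n (λ l _ → cong (λ b → if b then f (m ℕ.+ l) else + 0) (⌊<?⌋-false (ℕP.m≤m+n m l)))) ⟩
  ∑< m f + + 0
    ≡⟨ ℤP.+-identityʳ _ ⟩
  ∑< m f ∎
  where
    open ≡-Reasoning

∑-above : ∀ m n (f : ℕ → ℤ) →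
          ∑[ l < m ℕ.+ n ] (if not ⌊ l <? m ⌋ then f l else + 0) ≡ ∑[ l < n ] f (m ℕ.+ l)
∑-above m n f = begin
  ∑[ l < m ℕ.+ n ] (if not ⌊ l <? m ⌋ then f l else + 0)
    ≡⟨ ∑-+ m n _ ⟩
  (∑[ l < m ] (if not ⌊ l <? m ⌋ then f l else + 0))
    + (∑[ l < n ] (if not ⌊ m ℕ.+ l <? m ⌋ then f (m ℕ.+ l) else + 0))
    ≡⟨ cong₂ _+_ (∑-zero m (λ l l< → cong (λ b → if not b then f l else + 0) (⌊<?⌋-true l<)))
                 (∑-cong n (λ l _ → cong (λ b → if not b then f (m ℕ.+ l) else + 0) (⌊<?⌋-false (ℕP.m≤m+n m l)))) ⟩
  + 0 + (∑[ l < n ] f (m ℕ.+ l))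
    ≡⟨ ℤP.+-identityˡ _ ⟩
  ∑[ l < n ] f (m ℕ.+ l) ∎
  where
    open ≡-Reasoning

-- Kronecker delta

IsZeroOne : ℤ → Set
IsZeroOne z = z ≡ + 0 ⊎ z ≡ + 1

zeroOne-* : ∀ {x y} → IsZeroOne x → IsZeroOne y → IsZeroOne (x * y)
zeroOne-* (inj₁ refl) _            = inj₁ refl
zeroOne-* (inj₂ refl) (inj₁ y≡0) = inj₁ (trans (ℤP.*-identityˡ _) y≡0)
zeroOne-* (inj₂ refl) (inj₂ y≡1) = inj₂ (trans (ℤP.*-identityˡ _) y≡1)

δ : ℕ → ℕ → ℤ
δ i j = if ⌊ i ℕ.≟ j ⌋ then + 1 else + 0

δ-≡ : ∀ {i j} → i ≡ j → δ i j ≡ + 1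
δ-≡ {i} {j} i≡j with i ℕ.≟ j
... | yes _   = refl
... | no i≢j = ⊥-elim (i≢j i≡j)

δ-≢ : ∀ {i j} → ¬ i ≡ j → δ i j ≡ + 0
δ-≢ {i} {j} i≢j with i ℕ.≟ j
... | yes i≡j = ⊥-elim (i≢j i≡j)
... | no _    = refl

δ-zeroOne : ∀ i j → IsZeroOne (δ i j)
δ-zeroOne i j with i ℕ.≟ j
... | yes _ = inj₂ refl
... | no _  = inj₁ refl

δ-scaled-zeroOne : ∀ p q {e x} → e ≡ δ p q * x → IsZeroOne x → IsZeroOne e
δ-scaled-zeroOne p q e≡ x01 = subst IsZeroOne (sym e≡) (zeroOne-* (δ-zeroOne p q) x01)

δ-cong-⇔ : ∀ {i j i′ j′} → (i ≡ j → i′ ≡ j′) → (i′ ≡ j′ → i ≡ j) → δ i j ≡ δ i′ j′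
δ-cong-⇔ {i} {j} to from with i ℕ.≟ j
... | yes i≡j = sym (δ-≡ (to i≡j))
... | no i≢j  = sym (δ-≢ (λ e → i≢j (from e)))

δ-sym : ∀ i j → δ i j ≡ δ j i
δ-sym i j = δ-cong-⇔ sym sym

δ-+ˡ : ∀ c i j → δ (c ℕ.+ i) (c ℕ.+ j) ≡ δ i j
δ-+ˡ c i j = δ-cong-⇔ (ℕP.+-cancelˡ-≡ c i j) (cong (c ℕ.+_))

∑-δ : ∀ n {b} (f : ℕ → ℤ) → b < n → ∑[ j < n ] δ j b * f j ≡ f b
∑-δ (suc n) {zero} f _ = trans
  (cong₂ _+_ (ℤP.*-identityˡ (f 0))
             (∑-zero n (λ j _ → cong (_* f (suc j)) (δ-≢ {suc j} {0} (λ ())))))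
  (ℤP.+-identityʳ (f 0))
∑-δ (suc n) {suc b} f (s≤s b<n) = begin
  δ 0 (suc b) * f 0 + (∑[ j < n ] δ (suc j) (suc b) * f (suc j))
    ≡⟨ cong₂ _+_ (cong (_* f 0) (δ-≢ {0} {suc b} (λ ())))
                 (∑-cong n (λ j _ → cong (_* f (suc j)) (δ-+ˡ 1 j b))) ⟩
  + 0 * f 0 + (∑[ j < n ] δ j b * f (suc j))
    ≡⟨ ℤP.+-identityˡ _ ⟩
  ∑[ j < n ] δ j b * f (suc j)
    ≡⟨ ∑-δ n (λ j → f (suc j)) b<n ⟩
  f (suc b) ∎
  where
    open ≡-Reasoning

δ-⊗ : ∀ {M} x c {β b} → β < M → b < M → δ (x ℕ.* M ℕ.+ β) (c ℕ.* M ℕ.+ b) ≡ δ x c * δ β b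
δ-⊗         zero    zero    {β} {b} β< b< = sym (ℤP.*-identityˡ (δ β b))
δ-⊗ {M}     zero    (suc c) {β} {b} β< b< = trans
  (δ-≢ (ℕP.<⇒≢ (ℕP.<-≤-trans β< (ℕP.≤-trans (ℕP.m≤m+n M (c ℕ.* M)) (ℕP.m≤m+n _ b)))))
  (sym (ℤP.*-zeroˡ (δ β b)))
δ-⊗ {M}     (suc x) zero    {β} {b} β< b< = trans
  (δ-≢ (λ e → ℕP.<⇒≢ (ℕP.<-≤-trans b< (ℕP.≤-trans (ℕP.m≤m+n M (x ℕ.* M)) (ℕP.m≤m+n _ β))) (sym e)))
  (sym (ℤP.*-zeroˡ (δ β b)))
δ-⊗ {M}     (suc x) (suc c) {β} {b} β< b< = begin
  δ (M ℕ.+ x ℕ.* M ℕ.+ β) (M ℕ.+ c ℕ.* M ℕ.+ b)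
    ≡⟨ cong₂ δ (ℕP.+-assoc M _ β) (ℕP.+-assoc M _ b) ⟩
  δ (M ℕ.+ (x ℕ.* M ℕ.+ β)) (M ℕ.+ (c ℕ.* M ℕ.+ b))
    ≡⟨ δ-+ˡ M _ _ ⟩
  δ (x ℕ.* M ℕ.+ β) (c ℕ.* M ℕ.+ b)
    ≡⟨ δ-⊗ x c β< b< ⟩
  δ x c * δ β b
    ≡⟨ cong (_* δ β b) (sym (δ-+ˡ 1 x c)) ⟩
  δ (suc x) (suc c) * δ β b ∎
  where
    open ≡-Reasoning

bits-elim : (P : ℕ → ℕ → Set) → P 0 0 → P 0 1 → P 1 0 → P 1 1 →
            ∀ {u w} → u < 2 → w < 2 → P u w
bits-elim P p₀₀ p₀₁ p₁₀ p₁₁ {0}     {0}     _ _ = p₀₀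
bits-elim P p₀₀ p₀₁ p₁₀ p₁₁ {0}     {1}     _ _ = p₀₁
bits-elim P p₀₀ p₀₁ p₁₀ p₁₁ {1}     {0}     _ _ = p₁₀
bits-elim P p₀₀ p₀₁ p₁₀ p₁₁ {1}     {1}     _ _ = p₁₁
bits-elim P p₀₀ p₀₁ p₁₀ p₁₁ {suc (suc _)} (s≤s (s≤s ())) _
bits-elim P p₀₀ p₀₁ p₁₀ p₁₁ {_} {suc (suc _)} _ (s≤s (s≤s ()))

bit-elim : (P : ℕ → Set) → P 0 → P 1 → ∀ {u} → u < 2 → P u
bit-elim P p₀ p₁ u< = bits-elim (λ u _ → P u) p₀ p₀ p₁ p₁ u< u<

1∸-<2 : ∀ u → 1 ∸ u < 2
1∸-<2 zero    = s≤s (s≤s z≤n)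
1∸-<2 (suc u) = subst (_< 2) (sym (ℕP.0∸n≡0 u)) (s≤s z≤n)

∑₂-δ : ∀ {p} → p < 2 → ∑[ w < 2 ] δ p w ≡ + 1
∑₂-δ = bit-elim (λ p → ∑[ w < 2 ] δ p w ≡ + 1) refl refl

∑₂-δˡ : ∀ {q} → q < 2 → ∑[ w < 2 ] δ w q ≡ + 1
∑₂-δˡ = bit-elim (λ q → ∑[ w < 2 ] δ w q ≡ + 1) refl refl

∑₂-δ∸ : ∀ {q} → q < 2 → ∑[ w < 2 ] δ (1 ∸ w) q ≡ + 1
∑₂-δ∸ = bit-elim (λ q → ∑[ w < 2 ] δ (1 ∸ w) q ≡ + 1) refl refl

∑₂-δ-δ : ∀ {p q} → p < 2 → q < 2 → ∑[ w < 2 ] δ p w * δ w q ≡ δ p q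
∑₂-δ-δ = bits-elim (λ p q → ∑[ w < 2 ] δ p w * δ w q ≡ δ p q) refl refl refl refl

∑₂-δ-δ∸ : ∀ {p q} → p < 2 → q < 2 → ∑[ w < 2 ] δ p w * δ (1 ∸ w) q ≡ δ (1 ∸ p) q
∑₂-δ-δ∸ = bits-elim (λ p q → ∑[ w < 2 ] δ p w * δ (1 ∸ w) q ≡ δ (1 ∸ p) q) refl refl refl refl

δ+δ∸ : ∀ {p q} → p < 2 → q < 2 → δ p q + δ (1 ∸ p) q ≡ + 1
δ+δ∸ = bits-elim (λ p q → δ p q + δ (1 ∸ p) q ≡ + 1) refl refl refl refl

δ-K₂ˡ : ∀ {u w} → u < 2 → w < 2 → δ (u ℕ.+ w) 1 ≡ δ (1 ∸ u) w
δ-K₂ˡ = bits-elim (λ u w → δ (u ℕ.+ w) 1 ≡ δ (1 ∸ u) w) refl refl refl refl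

δ-flip : ∀ {u w} → u < 2 → w < 2 → δ (1 ∸ u) w ≡ δ u (1 ∸ w)
δ-flip = bits-elim (λ u w → δ (1 ∸ u) w ≡ δ u (1 ∸ w)) refl refl refl refl

δ-∸∸ : ∀ {u w} → u < 2 → w < 2 → δ u w ≡ δ (1 ∸ u) (1 ∸ w)
δ-∸∸ = bits-elim (λ u w → δ u w ≡ δ (1 ∸ u) (1 ∸ w)) refl refl refl refl

δ-∸-self : ∀ {u} → u < 2 → δ (1 ∸ u) u ≡ + 0
δ-∸-self = bit-elim (λ u → δ (1 ∸ u) u ≡ + 0) refl refl

-- Decomposing indices

data SumIndex (m n : ℕ) : ℕ → Set where
  inl : ∀ {x} → x < m → SumIndex m n x
  inr : ∀ {y} → y < n → SumIndex m n (m ℕ.+ y)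

sumIndex : ∀ m {n i} → i < m ℕ.+ n → SumIndex m n i
sumIndex zero                  i<  = inr i<
sumIndex (suc m) {i = zero}    _   = inl (s≤s z≤n)
sumIndex (suc m) {i = suc i} (s≤s i<) with sumIndex m i<
... | inl x< = inl (s≤s x<)
... | inr y< = inr y<

data ProductIndex (m n : ℕ) : ℕ → Set where
  pair : ∀ {x y} → x < m → y < n → ProductIndex m n (x ℕ.* n ℕ.+ y)

productIndex : ∀ {m n i} → i < m ℕ.* n → ProductIndex m n i
productIndex {m} {zero} {i} i< = ⊥-elim (ℕP.n≮0 (subst (i <_) (ℕP.*-zeroʳ m) i<))
productIndex {m} {suc n} {i} i< = subst (ProductIndex m (suc n)) i≡
  (pair (m<n*o⇒m/o<n i<) (m%n<n i (suc n)))
  where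
    i≡ : i / suc n ℕ.* suc n ℕ.+ i % suc n ≡ i
    i≡ = trans (ℕP.+-comm _ (i % suc n)) (sym (m≡m%n+[m/n]*n i (suc n)))

data NestedIndex (l m n : ℕ) : ℕ → Set where
  triple : ∀ {x y z} → x < l → y < m → z < n → NestedIndex l m n ((x ℕ.* m ℕ.+ y) ℕ.* n ℕ.+ z)

nestedIndex : ∀ {l m n i} → i < (l ℕ.* m) ℕ.* n → NestedIndex l m n i
nestedIndex {l} {m} {n} i< with productIndex {l ℕ.* m} {n} i<
... | pair xy< z< with productIndex {l} {m} xy<
...   | pair x< y< = triple x< y< z<

data BlockIndex (a d : ℕ) : ℕ → Set where
  front : ∀ {u y} → u < 2 → y < a → BlockIndex a d (u ℕ.* a ℕ.+ y)
  back  : ∀ {u y} → u < 2 → y < d → BlockIndex a d (2 ℕ.* a ℕ.+ (u ℕ.* d ℕ.+ y))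

blockIndex : ∀ a d {i} → i < 2 ℕ.* a ℕ.+ 2 ℕ.* d → BlockIndex a d i
blockIndex a d i< with sumIndex (2 ℕ.* a) i<
... | inl x< with productIndex {2} {a} x<
...   | pair u< y< = front u< y<
blockIndex a d i< | inr z< with productIndex {2} {d} z<
...   | pair u< y< = back u< y<

-- Products of block-structured rows and columns

-- With e_p the p-th unit vector of length 2, a row of shape p is (e_p ⊗ X | e_p ⊗ X′)
-- and a column of shape q is (e_q ⊗ Y ; e_{1-q} ⊗ Y′), both of length 2a + 2d.
record RowShape (a d : ℕ) (F : ℕ → ℤ) (p : ℕ) (X X′ : ℕ → ℤ) : Set where
  field
    shape<2  : p < 2
    on-front : ∀ {w y} → w < 2 → y < a → F (w ℕ.* a ℕ.+ y) ≡ δ p w * X y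
    on-back  : ∀ {w y} → w < 2 → y < d → F (2 ℕ.* a ℕ.+ (w ℕ.* d ℕ.+ y)) ≡ δ p w * X′ y

record ColShape (a d : ℕ) (G : ℕ → ℤ) (q : ℕ) (Y Y′ : ℕ → ℤ) : Set where
  field
    shape<2  : q < 2
    on-front : ∀ {w y} → w < 2 → y < a → G (w ℕ.* a ℕ.+ y) ≡ δ w q * Y y
    on-back  : ∀ {w y} → w < 2 → y < d → G (2 ℕ.* a ℕ.+ (w ℕ.* d ℕ.+ y)) ≡ δ (1 ∸ w) q * Y′ y

module _ {a d : ℕ} where

  ∑-blocks : ∀ (F : ℕ → ℤ) (c c′ X X′ : ℕ → ℤ) →
    (∀ {w y} → w < 2 → y < a → F (w ℕ.* a ℕ.+ y) ≡ c w * X y) →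
    (∀ {w y} → w < 2 → y < d → F (2 ℕ.* a ℕ.+ (w ℕ.* d ℕ.+ y)) ≡ c′ w * X′ y) →
    ∑< (2 ℕ.* a ℕ.+ 2 ℕ.* d) F ≡ ∑< 2 c * ∑< a X + ∑< 2 c′ * ∑< d X′
  ∑-blocks F c c′ X X′ F-front F-back =
    trans (∑-+ (2 ℕ.* a) (2 ℕ.* d) F)
          (cong₂ _+_ (∑-⊗ 2 a c X (λ _ _ → F-front)) (∑-⊗ 2 d c′ X′ (λ _ _ → F-back)))

  rowShape-∑ : ∀ {F p X X′} → RowShape a d F p X X′ →
               ∑< (2 ℕ.* a ℕ.+ 2 ℕ.* d) F ≡ ∑< a X + ∑< d X′
  rowShape-∑ {F} {p} {X} {X′} R = begin
    ∑< (2 ℕ.* a ℕ.+ 2 ℕ.* d) F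
      ≡⟨ ∑-blocks F (δ p) (δ p) X X′ on-front on-back ⟩
    ∑< 2 (δ p) * ∑< a X + ∑< 2 (δ p) * ∑< d X′
      ≡⟨ cong₂ (λ c c′ → c * ∑< a X + c′ * ∑< d X′) (∑₂-δ shape<2) (∑₂-δ shape<2) ⟩
    + 1 * ∑< a X + + 1 * ∑< d X′
      ≡⟨ cong₂ _+_ (ℤP.*-identityˡ (∑< a _)) (ℤP.*-identityˡ (∑< d _)) ⟩
    ∑< a X + ∑< d X′ ∎
    where
      open RowShape R
      open ≡-Reasoning

  colShape-∑ : ∀ {G q Y Y′} → ColShape a d G q Y Y′ →
               ∑< (2 ℕ.* a ℕ.+ 2 ℕ.* d) G ≡ ∑< a Y + ∑< d Y′
  colShape-∑ {G} {q} {Y} {Y′} C = begin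
    ∑< (2 ℕ.* a ℕ.+ 2 ℕ.* d) G
      ≡⟨ ∑-blocks G (λ w → δ w q) (λ w → δ (1 ∸ w) q) Y Y′ on-front on-back ⟩
    (∑[ w < 2 ] δ w q) * ∑< a Y + (∑[ w < 2 ] δ (1 ∸ w) q) * ∑< d Y′
      ≡⟨ cong₂ (λ c c′ → c * ∑< a Y + c′ * ∑< d Y′) (∑₂-δˡ shape<2) (∑₂-δ∸ shape<2) ⟩
    + 1 * ∑< a Y + + 1 * ∑< d Y′
      ≡⟨ cong₂ _+_ (ℤP.*-identityˡ (∑< a _)) (ℤP.*-identityˡ (∑< d _)) ⟩
    ∑< a Y + ∑< d Y′ ∎
    where
      open ColShape C
      open ≡-Reasoning

  shapes-∑-* : ∀ {F p X X′ G q Y Y′} → RowShape a d F p X X′ → ColShape a d G q Y Y′ →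
    ∑[ l < 2 ℕ.* a ℕ.+ 2 ℕ.* d ] F l * G l
      ≡ δ p q * (∑[ y < a ] X y * Y y) + δ (1 ∸ p) q * (∑[ y < d ] X′ y * Y′ y)
  shapes-∑-* {F} {p} {X} {X′} {G} {q} {Y} {Y′} R C = begin
    ∑[ l < 2 ℕ.* a ℕ.+ 2 ℕ.* d ] F l * G l
      ≡⟨ ∑-blocks (λ l → F l * G l) (λ w → δ p w * δ w q) (λ w → δ p w * δ (1 ∸ w) q)
                  (λ y → X y * Y y) (λ y → X′ y * Y′ y)
                  (λ {w} {y} w< y< → trans (cong₂ _*_ (R.on-front w< y<) (C.on-front w< y<))
                                             (interchange (δ p w) (X y) (δ w q) (Y y)))
                  (λ {w} {y} w< y< → trans (cong₂ _*_ (R.on-back w< y<) (C.on-back w< y<))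
                                             (interchange (δ p w) (X′ y) (δ (1 ∸ w) q) (Y′ y))) ⟩
    (∑[ w < 2 ] δ p w * δ w q) * (∑[ y < a ] X y * Y y)
      + (∑[ w < 2 ] δ p w * δ (1 ∸ w) q) * (∑[ y < d ] X′ y * Y′ y)
      ≡⟨ cong₂ (λ c c′ → c * (∑[ y < a ] X y * Y y) + c′ * (∑[ y < d ] X′ y * Y′ y))
               (∑₂-δ-δ R.shape<2 C.shape<2) (∑₂-δ-δ∸ R.shape<2 C.shape<2) ⟩
    δ p q * (∑[ y < a ] X y * Y y) + δ (1 ∸ p) q * (∑[ y < d ] X′ y * Y′ y) ∎
    where
      module R = RowShape R
      module C = ColShape C
      open ≡-Reasoning

  shapes-law : ∀ {F p X X′ G q Y Y′} (s t : ℤ) {W Z : ℤ} →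
    RowShape a d F p X X′ → ColShape a d G q Y Y′ → W ≡ δ p q * Z →
    (∑[ y < a ] X y * Y y) + s * Z ≡ t → ∑[ y < d ] X′ y * Y′ y ≡ t →
    (∑[ l < 2 ℕ.* a ℕ.+ 2 ℕ.* d ] F l * G l) + s * W ≡ t
  shapes-law {F} {p} {X} {X′} {G} {q} {Y} {Y′} s t {W} {Z} R C W≡ law law′ = begin
    (∑[ l < 2 ℕ.* a ℕ.+ 2 ℕ.* d ] F l * G l) + s * W
      ≡⟨ cong₂ (λ S w → S + s * w) (shapes-∑-* R C) W≡ ⟩
    (δ p q * S + δ (1 ∸ p) q * S′) + s * (δ p q * Z)
      ≡⟨ regroup (δ p q) (δ (1 ∸ p) q) S S′ s Z ⟩
    δ p q * (S + s * Z) + δ (1 ∸ p) q * S′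
      ≡⟨ cong₂ (λ x y → δ p q * x + δ (1 ∸ p) q * y) law law′ ⟩
    δ p q * t + δ (1 ∸ p) q * t
      ≡⟨ sym (ℤP.*-distribʳ-+ t (δ p q) (δ (1 ∸ p) q)) ⟩
    (δ p q + δ (1 ∸ p) q) * t
      ≡⟨ cong (_* t) (δ+δ∸ (RowShape.shape<2 R) (ColShape.shape<2 C)) ⟩
    + 1 * t
      ≡⟨ ℤP.*-identityˡ t ⟩
    t ∎
    where
      open ≡-Reasoning
      S S′ : ℤ
      S  = ∑[ y < a ] X y * Y y
      S′ = ∑[ y < d ] X′ y * Y′ y
      regroup : ∀ c c′ S S′ s Z → (c * S + c′ * S′) + s * (c * Z) ≡ c * (S + s * Z) + c′ * S′
      regroup = ℤSolver.solve-∀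

-- Block-indicator rows and balanced columns

BlockIndicatorRow : (ℕ → ℕ → ℤ) → (N L i : ℕ) → Set
BlockIndicatorRow X N L i =
  Σ[ b ∈ ℕ ] b < N × (∀ {β γ} → β < N → γ < L → X i (β ℕ.* L ℕ.+ γ) ≡ δ β b)

BalancedColumn : (ℕ → ℕ → ℤ) → (N L t j : ℕ) → Set
BalancedColumn Y N L t j = ∀ {b} → b < N → ∑[ γ < L ] Y (b ℕ.* L ℕ.+ γ) j ≡ + t

indicator-balanced-∑ : ∀ {X Y N L t i j} → BlockIndicatorRow X N L i → BalancedColumn Y N L t j →
                       ∑[ l < N ℕ.* L ] X i l * Y l j ≡ + t
indicator-balanced-∑ {X} {Y} {N} {L} {t} {i} {j} (b , b<N , row) col = begin
  ∑[ l < N ℕ.* L ] X i l * Y l j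
    ≡⟨ ∑-* N L _ ⟩
  ∑[ β < N ] ∑[ γ < L ] X i (β ℕ.* L ℕ.+ γ) * Y (β ℕ.* L ℕ.+ γ) j
    ≡⟨ ∑-cong N (λ β β< → ∑-cong L (λ γ γ< → cong (_* Y (β ℕ.* L ℕ.+ γ) j) (row β< γ<))) ⟩
  ∑[ β < N ] ∑[ γ < L ] δ β b * Y (β ℕ.* L ℕ.+ γ) j
    ≡⟨ ∑-cong N (λ β _ → ∑-distribˡ L (δ β b) _) ⟩
  ∑[ β < N ] δ β b * (∑[ γ < L ] Y (β ℕ.* L ℕ.+ γ) j)
    ≡⟨ ∑-δ N _ b<N ⟩
  ∑[ γ < L ] Y (b ℕ.* L ℕ.+ γ) j
    ≡⟨ col b<N ⟩
  + t ∎
  where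
    open ≡-Reasoning

indicator-∑ : ∀ {X N L i} → BlockIndicatorRow X N L i → ∑[ l < N ℕ.* L ] X i l ≡ + L
indicator-∑ {X} {N} {L} {i} row = trans
  (∑-cong (N ℕ.* L) (λ l _ → sym (ℤP.*-identityʳ (X i l))))
  (indicator-balanced-∑ {X = X} {Y = λ _ _ → + 1} {i = i} {j = 0} row
    (λ _ → trans (∑-const L (+ 1)) (ℤP.*-identityʳ (+ L))))

balanced-∑ : ∀ {Y N L t j} → BalancedColumn Y N L t j → ∑[ l < N ℕ.* L ] Y l j ≡ + (N ℕ.* t)
balanced-∑ {Y} {N} {L} {t} {j} col = begin
  ∑[ l < N ℕ.* L ] Y l j                          ≡⟨ ∑-* N L _ ⟩
  ∑[ β < N ] ∑[ γ < L ] Y (β ℕ.* L ℕ.+ γ) j       ≡⟨ ∑-cong N (λ _ β< → col β<) ⟩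
  ∑[ _ < N ] + t                                  ≡⟨ ∑-const N (+ t) ⟩
  + N * + t                                       ≡⟨ sym (ℤP.pos-* N t) ⟩
  + (N ℕ.* t)                                     ∎
  where
    open ≡-Reasoning

indicator-zeroOne : ∀ {X N L i j} → BlockIndicatorRow X N L i → j < N ℕ.* L → IsZeroOne (X i j)
indicator-zeroOne {X} {N} {L} {i} (b , _ , row) j< with productIndex {N} {L} j<
... | pair β< γ< = subst IsZeroOne (sym (row β< γ<)) (δ-zeroOne _ b)

-- Matrices as functions on ℕ × ℕ

-- extend X is 0 outside the index range of X, and no lemma below looks there; reading
-- matrices on ℕ × ℕ turns block and Kronecker indices into plain arithmetic.
abstract
  extend : ∀ {m n} → Mat m n → ℕ → ℕ → ℤ
  extend {m} {n} X i j with i <? m | j <? n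
  ... | yes i<m | yes j<n = X (fromℕ< i<m) (fromℕ< j<n)
  ... | _       | _       = + 0

  extend-fromℕ< : ∀ {m n} (X : Mat m n) {i j} (i<m : i < m) (j<n : j < n) →
                  extend X i j ≡ X (fromℕ< i<m) (fromℕ< j<n)
  extend-fromℕ< {m} {n} X {i} {j} i<m j<n with i <? m | j <? n
  ... | yes _   | yes _   = refl
  ... | no i≮m  | _       = ⊥-elim (i≮m i<m)
  ... | yes _   | no j≮n  = ⊥-elim (j≮n j<n)

extend-toℕ : ∀ {m n} (X : Mat m n) i j → extend X (toℕ i) (toℕ j) ≡ X i j
extend-toℕ X i j = trans (extend-fromℕ< X (FinP.toℕ<n i) (FinP.toℕ<n j))
                         (cong₂ X (FinP.fromℕ<-toℕ i _) (FinP.fromℕ<-toℕ j _))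

fromℕ<-unique : ∀ {m i} (i<m : i < m) {x : Fin m} → toℕ x ≡ i → fromℕ< i<m ≡ x
fromℕ<-unique i<m x≡i = FinP.toℕ-injective (trans (FinP.toℕ-fromℕ< i<m) (sym x≡i))

≋-extend : ∀ {m n} {X Y : Mat m n} →
           (∀ i j → i < m → j < n → extend X i j ≡ extend Y i j) → X ≋ Y
≋-extend {X = X} {Y} e i j =
  trans (sym (extend-toℕ X i j)) (trans (e _ _ (FinP.toℕ<n i) (FinP.toℕ<n j)) (extend-toℕ Y i j))

extend-≋ : ∀ {m n} {X Y : Mat m n} → X ≋ Y →
           ∀ {i j} → i < m → j < n → extend X i j ≡ extend Y i j
extend-≋ {X = X} {Y} X≋Y i<m j<n =
  trans (extend-fromℕ< X i<m j<n) (trans (X≋Y _ _) (sym (extend-fromℕ< Y i<m j<n)))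

module _ {m n} {i j} (i<m : i < m) (j<n : j < n) where

  extend-⊕ : (X Y : Mat m n) → extend (X ⊕ Y) i j ≡ extend X i j + extend Y i j
  extend-⊕ X Y = trans (extend-fromℕ< _ i<m j<n)
    (sym (cong₂ _+_ (extend-fromℕ< X i<m j<n) (extend-fromℕ< Y i<m j<n)))

  extend-⊖ : (X Y : Mat m n) → extend (X ⊖ Y) i j ≡ extend X i j - extend Y i j
  extend-⊖ X Y = trans (extend-fromℕ< _ i<m j<n)
    (sym (cong₂ _-_ (extend-fromℕ< X i<m j<n) (extend-fromℕ< Y i<m j<n)))

  extend-· : (c : ℤ) (X : Mat m n) → extend (c · X) i j ≡ c * extend X i j
  extend-· c X = trans (extend-fromℕ< _ i<m j<n) (sym (cong (c *_) (extend-fromℕ< X i<m j<n)))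

  extend-J : extend (J m n) i j ≡ + 1
  extend-J = extend-fromℕ< (J m n) i<m j<n

module _ {m} {i j} (i<m : i < m) (j<m : j < m) where

  extend-I : extend (I m) i j ≡ δ i j
  extend-I = trans (extend-fromℕ< (I m) i<m j<m)
    (cong₂ (λ x y → if ⌊ x ℕ.≟ y ⌋ then + 1 else + 0) (FinP.toℕ-fromℕ< i<m) (FinP.toℕ-fromℕ< j<m))

  extend-K : extend (K m) i j ≡ δ (i ℕ.+ j) (m ∸ 1)
  extend-K = trans (extend-fromℕ< (K m) i<m j<m)
    (cong₂ (λ x y → if ⌊ x ℕ.+ y ℕ.≟ m ∸ 1 ⌋ then + 1 else + 0) (FinP.toℕ-fromℕ< i<m) (FinP.toℕ-fromℕ< j<m))

sumF-cong : ∀ {n} {f g : Fin n → ℤ} → (∀ j → f j ≡ g j) → sumF f ≡ sumF g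
sumF-cong {zero}  e = refl
sumF-cong {suc n} e = cong₂ _+_ (e Fin.zero) (sumF-cong (λ j → e (Fin.suc j)))

sumF-toℕ : ∀ {n} (g : ℕ → ℤ) → sumF {n} (λ j → g (toℕ j)) ≡ ∑< n g
sumF-toℕ {zero}  g = refl
sumF-toℕ {suc n} g = cong (_+_ (g 0)) (sumF-toℕ {n} (λ j → g (suc j)))

extend-⊛ : ∀ {m n p} (X : Mat m n) (Y : Mat n p) {i k} → i < m → k < p →
           extend (X ⊛ Y) i k ≡ ∑[ j < n ] extend X i j * extend Y j k
extend-⊛ {n = n} X Y {i} {k} i<m k<p = begin
  extend (X ⊛ Y) i k
    ≡⟨ extend-fromℕ< (X ⊛ Y) i<m k<p ⟩
  sumF {n} (λ j → X (fromℕ< i<m) j * Y j (fromℕ< k<p))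
    ≡⟨ sumF-cong {n} (λ j → sym (cong₂ _*_ (trans (extend-fromℕ< X i<m (FinP.toℕ<n j)) (cong (X _) (FinP.fromℕ<-toℕ j _)))
                                         (trans (extend-fromℕ< Y (FinP.toℕ<n j) k<p) (cong (λ z → Y z _) (FinP.fromℕ<-toℕ j _))))) ⟩
  sumF {n} (λ j → extend X i (toℕ j) * extend Y (toℕ j) k)
    ≡⟨ sumF-toℕ {n} (λ j → extend X i j * extend Y j k) ⟩
  ∑[ j < n ] extend X i j * extend Y j k ∎
  where
    open ≡-Reasoning

<-⊗ : ∀ {x y m n} → x < m → y < n → x ℕ.* n ℕ.+ y < m ℕ.* n
<-⊗ {x} {y} {m} {n} x<m y<n = begin-strict
  x ℕ.* n ℕ.+ y  <⟨ ℕP.+-monoʳ-< (x ℕ.* n) y<n ⟩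
  x ℕ.* n ℕ.+ n  ≡⟨ ℕP.+-comm (x ℕ.* n) n ⟩
  suc x ℕ.* n    ≤⟨ ℕP.*-monoˡ-≤ n x<m ⟩
  m ℕ.* n        ∎
  where
    open ℕP.≤-Reasoning

extend-⊗ : ∀ {m n p q} (X : Mat m n) (Y : Mat p q) {a b c e} →
           a < m → b < p → c < n → e < q →
           extend (X ⊗ Y) (a ℕ.* p ℕ.+ b) (c ℕ.* q ℕ.+ e) ≡ extend X a c * extend Y b e
extend-⊗ {m} {n} {p} {q} X Y a<m b<p c<n e<q = begin
  extend (X ⊗ Y) _ _
    ≡⟨ extend-fromℕ< (X ⊗ Y) (<-⊗ a<m b<p) (<-⊗ c<n e<q) ⟩
  (X ⊗ Y) (fromℕ< (<-⊗ a<m b<p)) (fromℕ< (<-⊗ c<n e<q))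
    ≡⟨ cong₂ (X ⊗ Y) (fromℕ<-combine a<m b<p) (fromℕ<-combine c<n e<q) ⟩
  (X ⊗ Y) (combine (fromℕ< a<m) (fromℕ< b<p)) (combine (fromℕ< c<n) (fromℕ< e<q))
    ≡⟨ cong₂ (λ r s → X (proj₁ r) (proj₁ s) * Y (proj₂ r) (proj₂ s))
             (FinP.remQuot-combine {m} {p} (fromℕ< a<m) (fromℕ< b<p))
             (FinP.remQuot-combine {n} {q} (fromℕ< c<n) (fromℕ< e<q)) ⟩
  X (fromℕ< a<m) (fromℕ< c<n) * Y (fromℕ< b<p) (fromℕ< e<q)
    ≡⟨ sym (cong₂ _*_ (extend-fromℕ< X a<m c<n) (extend-fromℕ< Y b<p e<q)) ⟩
  extend X _ _ * extend Y _ _ ∎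
  where
    open ≡-Reasoning
    fromℕ<-combine : ∀ {x y m n} (x<m : x < m) (y<n : y < n) →
                     fromℕ< (<-⊗ x<m y<n) ≡ combine (fromℕ< x<m) (fromℕ< y<n)
    fromℕ<-combine {x} {y} {n = n} x<m y<n = fromℕ<-unique (<-⊗ x<m y<n)
      (trans (FinP.toℕ-combine (fromℕ< x<m) (fromℕ< y<n))
        (trans (cong₂ (λ x′ y′ → n ℕ.* x′ ℕ.+ y′) (FinP.toℕ-fromℕ< x<m) (FinP.toℕ-fromℕ< y<n))
               (cong (ℕ._+ y) (ℕP.*-comm n x))))

extend-castM : ∀ {m m′ n n′} (eqᵣ : m ≡ m′) (eqc : n ≡ n′) (X : Mat m n) {i j} →
               i < m → j < n → extend (castM eqᵣ eqc X) i j ≡ extend X i j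
extend-castM refl refl X i<m j<n =
  trans (extend-fromℕ< _ i<m j<n)
        (trans (cong₂ X (FinP.cast-is-id refl _) (FinP.cast-is-id refl _))
               (sym (extend-fromℕ< X i<m j<n)))

hcat-↑ˡ : ∀ {m l₁ l₂} (X : Mat m l₁) (Y : Mat m l₂) i j → hcat X Y i (j ↑ˡ l₂) ≡ X i j
hcat-↑ˡ {l₁ = l₁} {l₂} X Y i j rewrite FinP.splitAt-↑ˡ l₁ j l₂ = refl

hcat-↑ʳ : ∀ {m l₁ l₂} (X : Mat m l₁) (Y : Mat m l₂) i j → hcat X Y i (l₁ ↑ʳ j) ≡ Y i j
hcat-↑ʳ {l₁ = l₁} {l₂} X Y i j rewrite FinP.splitAt-↑ʳ l₁ l₂ j = refl

vcat-↑ˡ : ∀ {m₁ m₂ l} (X : Mat m₁ l) (Y : Mat m₂ l) i j → vcat X Y (i ↑ˡ m₂) j ≡ X i j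
vcat-↑ˡ {m₁} {m₂} X Y i j rewrite FinP.splitAt-↑ˡ m₁ i m₂ = refl

vcat-↑ʳ : ∀ {m₁ m₂ l} (X : Mat m₁ l) (Y : Mat m₂ l) i j → vcat X Y (m₁ ↑ʳ i) j ≡ Y i j
vcat-↑ʳ {m₁} {m₂} X Y i j rewrite FinP.splitAt-↑ʳ m₁ m₂ i = refl

fromℕ<-↑ˡ : ∀ {i m} n (i<m : i < m) → fromℕ< (ℕP.<-≤-trans i<m (ℕP.m≤m+n m n)) ≡ fromℕ< i<m ↑ˡ n
fromℕ<-↑ˡ {m = m} n i<m = fromℕ<-unique (ℕP.<-≤-trans i<m (ℕP.m≤m+n m n)) (trans (FinP.toℕ-↑ˡ (fromℕ< i<m) n) (FinP.toℕ-fromℕ< i<m))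

fromℕ<-↑ʳ : ∀ {i n} m (i<n : i < n) → fromℕ< (ℕP.+-monoʳ-< m i<n) ≡ m ↑ʳ fromℕ< i<n
fromℕ<-↑ʳ m i<n = fromℕ<-unique (ℕP.+-monoʳ-< m i<n) (trans (FinP.toℕ-↑ʳ m (fromℕ< i<n)) (cong (m ℕ.+_) (FinP.toℕ-fromℕ< i<n)))

module _ {m l₁ l₂} (X : Mat m l₁) (Y : Mat m l₂) {i} (i<m : i < m) where

  extend-hcatˡ : ∀ {j} → j < l₁ → extend (hcat X Y) i j ≡ extend X i j
  extend-hcatˡ j<l = trans (extend-fromℕ< (hcat X Y) i<m (ℕP.<-≤-trans j<l (ℕP.m≤m+n l₁ l₂)))
    (trans (cong (hcat X Y (fromℕ< i<m)) (fromℕ<-↑ˡ l₂ j<l))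
    (trans (hcat-↑ˡ X Y (fromℕ< i<m) (fromℕ< j<l)) (sym (extend-fromℕ< X i<m j<l))))

  extend-hcatʳ : ∀ {j} → j < l₂ → extend (hcat X Y) i (l₁ ℕ.+ j) ≡ extend Y i j
  extend-hcatʳ j<l = trans (extend-fromℕ< (hcat X Y) i<m (ℕP.+-monoʳ-< l₁ j<l))
    (trans (cong (hcat X Y (fromℕ< i<m)) (fromℕ<-↑ʳ l₁ j<l))
    (trans (hcat-↑ʳ X Y (fromℕ< i<m) (fromℕ< j<l)) (sym (extend-fromℕ< Y i<m j<l))))

module _ {m₁ m₂ l} (X : Mat m₁ l) (Y : Mat m₂ l) {j} (j<l : j < l) where

  extend-vcatˡ : ∀ {i} → i < m₁ → extend (vcat X Y) i j ≡ extend X i j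
  extend-vcatˡ i<m = trans (extend-fromℕ< (vcat X Y) (ℕP.<-≤-trans i<m (ℕP.m≤m+n m₁ m₂)) j<l)
    (trans (cong (λ r → vcat X Y r (fromℕ< j<l)) (fromℕ<-↑ˡ m₂ i<m))
    (trans (vcat-↑ˡ X Y (fromℕ< i<m) (fromℕ< j<l)) (sym (extend-fromℕ< X i<m j<l))))

  extend-vcatʳ : ∀ {i} → i < m₂ → extend (vcat X Y) (m₁ ℕ.+ i) j ≡ extend Y i j
  extend-vcatʳ i<m = trans (extend-fromℕ< (vcat X Y) (ℕP.+-monoʳ-< m₁ i<m) j<l)
    (trans (cong (λ r → vcat X Y r (fromℕ< j<l)) (fromℕ<-↑ʳ m₁ i<m))
    (trans (vcat-↑ʳ X Y (fromℕ< i<m) (fromℕ< j<l)) (sym (extend-fromℕ< Y i<m j<l))))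

extend-α : ∀ {m l} s′ .{{_ : NonZero s′}} (X : Mat m l) {i j} →
           i < m / s′ → j < l → extend (α s′ X) i j ≡ extend X i j
extend-α {m} s′ X {i} i<m/s j<l = trans (extend-fromℕ< (α s′ X) i<m/s j<l)
  (trans (cong (λ r → X r _) (sym (fromℕ<-unique i<m (trans (FinP.toℕ-inject≤ _ _) (FinP.toℕ-fromℕ< i<m/s)))))
         (sym (extend-fromℕ< X i<m j<l)))
  where
    i<m : i < m
    i<m = ℕP.<-≤-trans i<m/s (m/n≤m m s′)

module _ {a b c d} (X : Mat a c) (Y : Mat a d) (Z : Mat b c) (W : Mat b d) where

  extend-block₁₁ : ∀ {i j} → i < a → j < c → extend (block X Y Z W) i j ≡ extend X i j
  extend-block₁₁ i< j< = trans (extend-vcatˡ (hcat X Y) (hcat Z W) (ℕP.<-≤-trans j< (ℕP.m≤m+n c d)) i<)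
                               (extend-hcatˡ X Y i< j<)

  extend-block₁₂ : ∀ {i j} → i < a → j < d → extend (block X Y Z W) i (c ℕ.+ j) ≡ extend Y i j
  extend-block₁₂ i< j< = trans (extend-vcatˡ (hcat X Y) (hcat Z W) (ℕP.+-monoʳ-< c j<) i<)
                               (extend-hcatʳ X Y i< j<)

  extend-block₂₁ : ∀ {i j} → i < b → j < c → extend (block X Y Z W) (a ℕ.+ i) j ≡ extend Z i j
  extend-block₂₁ i< j< = trans (extend-vcatʳ (hcat X Y) (hcat Z W) (ℕP.<-≤-trans j< (ℕP.m≤m+n c d)) i<)
                               (extend-hcatˡ Z W i< j<)

  extend-block₂₂ : ∀ {i j} → i < b → j < d → extend (block X Y Z W) (a ℕ.+ i) (c ℕ.+ j) ≡ extend W i j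
  extend-block₂₂ i< j< = trans (extend-vcatʳ (hcat X Y) (hcat Z W) (ℕP.+-monoʳ-< c j<) i<)
                               (extend-hcatʳ Z W i< j<)

module _ {p q} (X : Mat p q) {u w y y′} (u< : u < 2) (w< : w < 2) (y< : y < p) (y′< : y′ < q) where

  extend-I₂⊗ : extend (I 2 ⊗ X) (u ℕ.* p ℕ.+ y) (w ℕ.* q ℕ.+ y′) ≡ δ u w * extend X y y′
  extend-I₂⊗ = trans (extend-⊗ (I 2) X u< y< w< y′<) (cong (_* extend X y y′) (extend-I u< w<))

  extend-K₂⊗ : extend (K 2 ⊗ X) (u ℕ.* p ℕ.+ y) (w ℕ.* q ℕ.+ y′) ≡ δ (1 ∸ u) w * extend X y y′
  extend-K₂⊗ = trans (extend-⊗ (K 2) X u< y< w< y′<)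
                     (cong (_* extend X y y′) (trans (extend-K u< w<) (δ-K₂ˡ u< w<)))

extend-⊗J : ∀ {m n l} (X : Mat m n) {i j z} → i < m → j < n → z < l →
            extend (X ⊗ J 1 l) i (j ℕ.* l ℕ.+ z) ≡ extend X i j
extend-⊗J {l = l} X {i} {j} {z} i< j< z< = begin
  extend (X ⊗ J 1 l) i (j ℕ.* l ℕ.+ z)
    ≡⟨ cong (λ r → extend (X ⊗ J 1 l) r (j ℕ.* l ℕ.+ z)) (sym (trans (ℕP.+-identityʳ _) (ℕP.*-identityʳ i))) ⟩
  extend (X ⊗ J 1 l) (i ℕ.* 1 ℕ.+ 0) (j ℕ.* l ℕ.+ z)
    ≡⟨ extend-⊗ X (J 1 l) i< (s≤s z≤n) j< z< ⟩
  extend X i j * extend (J 1 l) 0 z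
    ≡⟨ cong (extend X i j *_) (extend-J (s≤s z≤n) z<) ⟩
  extend X i j * + 1
    ≡⟨ ℤP.*-identityʳ _ ⟩
  extend X i j ∎
  where
    open ≡-Reasoning

extend-J⊗I₂ : ∀ {m p q w} → p < m → q < 2 → w < 2 → extend (J m 1 ⊗ I 2) (p ℕ.* 2 ℕ.+ q) w ≡ δ q w
extend-J⊗I₂ {m} p< q< w< = trans (extend-⊗ (J m 1) (I 2) {c = 0} p< q< (s≤s z≤n) w<)
  (trans (cong₂ _*_ (extend-J p< (s≤s z≤n)) (extend-I q< w<)) (ℤP.*-identityˡ _))

module _ {m l r} {X : Mat m l} {Y : Mat l r} {i j} (i< : i < m) (j< : j < r) where

  product-entry : ∀ {e} → X ⊛ Y ≋ e · J m r → ∑[ h < l ] extend X i h * extend Y h j ≡ e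
  product-entry {e} XY≋ = begin
    ∑[ h < l ] extend X i h * extend Y h j   ≡⟨ sym (extend-⊛ X Y i< j<) ⟩
    extend (X ⊛ Y) i j                       ≡⟨ extend-≋ XY≋ i< j< ⟩
    extend (e · J m r) i j                   ≡⟨ extend-· i< j< e (J m r) ⟩
    e * extend (J m r) i j                   ≡⟨ cong (e *_) (extend-J i< j<) ⟩
    e * + 1                                  ≡⟨ ℤP.*-identityʳ e ⟩
    e                                        ∎
    where
      open ≡-Reasoning

  law-entry : ∀ {Z : Mat m r} {c e} → X ⊛ Y ⊕ c · Z ≋ e · J m r →
              (∑[ h < l ] extend X i h * extend Y h j) + c * extend Z i j ≡ e
  law-entry {Z} {c} {e} law = begin
    (∑[ h < l ] extend X i h * extend Y h j) + c * extend Z i j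
      ≡⟨ sym (cong₂ _+_ (extend-⊛ X Y i< j<) (extend-· i< j< c Z)) ⟩
    extend (X ⊛ Y) i j + extend (c · Z) i j
      ≡⟨ sym (extend-⊕ i< j< (X ⊛ Y) (c · Z)) ⟩
    extend (X ⊛ Y ⊕ c · Z) i j
      ≡⟨ extend-≋ law i< j< ⟩
    extend (e · J m r) i j
      ≡⟨ extend-· i< j< e (J m r) ⟩
    e * extend (J m r) i j
      ≡⟨ cong (e *_) (extend-J i< j<) ⟩
    e * + 1
      ≡⟨ ℤP.*-identityʳ e ⟩
    e ∎
    where
      open ≡-Reasoning

SRD-rhs : ∀ {m} (X : Mat m m) (t lm : ℤ) → Mat m m
SRD-rhs {m} X t lm = t · I m ⊕ lm · X ⊕ t · (J m m ⊖ I m ⊖ X)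

extend-SRD-rhs : ∀ {m} (X : Mat m m) (t lm : ℤ) {i j} → i < m → j < m →
  extend (SRD-rhs X t lm) i j ≡ t * δ i j + lm * extend X i j + t * (+ 1 - δ i j - extend X i j)
extend-SRD-rhs {m} X t lm {i} {j} i< j< = begin
  extend (t · I m ⊕ lm · X ⊕ t · (J m m ⊖ I m ⊖ X)) i j
    ≡⟨ extend-⊕ i< j< (t · I m ⊕ lm · X) (t · (J m m ⊖ I m ⊖ X)) ⟩
  extend (t · I m ⊕ lm · X) i j + extend (t · (J m m ⊖ I m ⊖ X)) i j
    ≡⟨ cong₂ _+_ (trans (extend-⊕ i< j< (t · I m) (lm · X))
                        (cong₂ _+_ (trans (extend-· i< j< t (I m)) (cong (t *_) (extend-I i< j<)))
                                   (extend-· i< j< lm X)))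
                 (trans (extend-· i< j< t (J m m ⊖ I m ⊖ X)) (cong (t *_)
                   (trans (extend-⊖ i< j< (J m m ⊖ I m) X)
                          (cong (_- extend X i j) (trans (extend-⊖ i< j< (J m m) (I m))
                                                         (cong₂ _-_ (extend-J i< j<) (extend-I i< j<))))))) ⟩
  t * δ i j + lm * extend X i j + t * (+ 1 - δ i j - extend X i j) ∎
  where
    open ≡-Reasoning

srd-law : ∀ {m} {X : Mat m m} {t lm : ℤ} → X ⊛ X ≋ SRD-rhs X t lm →
  ∀ {i j} → i < m → j < m → (∑[ h < m ] extend X i h * extend X h j) + (t - lm) * extend X i j ≡ t
srd-law {m} {X} {t} {lm} X²≋ {i} {j} i< j< = begin
  (∑[ h < m ] extend X i h * extend X h j) + (t - lm) * extend X i j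
    ≡⟨ cong (_+ (t - lm) * extend X i j)
            (trans (sym (extend-⊛ X X i< j<)) (trans (extend-≋ X²≋ i< j<) (extend-SRD-rhs X t lm i< j<))) ⟩
  t * δ i j + lm * extend X i j + t * (+ 1 - δ i j - extend X i j) + (t - lm) * extend X i j
    ≡⟨ collapse t lm (δ i j) (extend X i j) ⟩
  t ∎
  where
    open ≡-Reasoning
    collapse : ∀ t lm e x → t * e + lm * x + t * (+ 1 - e - x) + (t - lm) * x ≡ t
    collapse = ℤSolver.solve-∀

law-srd : ∀ {m} {X : Mat m m} {t lm : ℤ} →
  (∀ {i j} → i < m → j < m → (∑[ h < m ] extend X i h * extend X h j) + (t - lm) * extend X i j ≡ t) →
  X ⊛ X ≋ SRD-rhs X t lm
law-srd {m} {X} {t} {lm} law = ≋-extend λ i j i< j< → begin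
  extend (X ⊛ X) i j
    ≡⟨ extend-⊛ X X i< j< ⟩
  ∑[ h < m ] extend X i h * extend X h j
    ≡⟨ isolate (∑[ h < m ] extend X i h * extend X h j) t lm (δ i j) (extend X i j) (law i< j<) ⟩
  t * δ i j + lm * extend X i j + t * (+ 1 - δ i j - extend X i j)
    ≡⟨ sym (extend-SRD-rhs X t lm i< j<) ⟩
  extend (SRD-rhs X t lm) i j ∎
  where
    open ≡-Reasoning
    isolate : ∀ S t lm e x → S + (t - lm) * x ≡ t → S ≡ t * e + lm * x + t * (+ 1 - e - x)
    isolate S t lm e x eq = trans (shift S t lm x) (trans (cong (_+ ℤ.- ((t - lm) * x)) eq) (expand t lm e x))
      where
        shift : ∀ S t lm x → S ≡ (S + (t - lm) * x) + ℤ.- ((t - lm) * x)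
        shift = ℤSolver.solve-∀
        expand : ∀ t lm e x → t + ℤ.- ((t - lm) * x) ≡ t * e + lm * x + t * (+ 1 - e - x)
        expand = ℤSolver.solve-∀

row-sum-entry : ∀ {m r} {X : Mat m r} {e} → X ⊛ J r r ≋ e · J m r →
                ∀ {i} → i < m → 0 < r → ∑[ h < r ] extend X i h ≡ e
row-sum-entry {m} {r} {X} XJ≋ {i} i< 0<r = trans
  (∑-cong r (λ h h< → trans (sym (ℤP.*-identityʳ _)) (cong (extend X i h *_) (sym (extend-J h< 0<r)))))
  (product-entry {X = X} {Y = J r r} i< 0<r XJ≋)

col-sum-entry : ∀ {m r} {X : Mat m r} {e} → J m m ⊛ X ≋ e · J m r →
                ∀ {j} → j < r → 0 < m → ∑[ h < m ] extend X h j ≡ e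
col-sum-entry {m} {r} {X} JX≋ {j} j< 0<m = trans
  (∑-cong m (λ h h< → trans (sym (ℤP.*-identityˡ _)) (cong (_* extend X h j) (sym (extend-J 0<m h<)))))
  (product-entry {X = J m m} {Y = X} 0<m j< JX≋)

⊛J-from-rowSums : ∀ {m r} {X : Mat m r} {e} → (∀ {i} → i < m → ∑[ h < r ] extend X i h ≡ e) →
                  X ⊛ J r r ≋ e · J m r
⊛J-from-rowSums {m} {r} {X} {e} rowSum = ≋-extend λ i j i< j< → begin
  extend (X ⊛ J r r) i j                 ≡⟨ extend-⊛ X (J r r) i< j< ⟩
  ∑[ h < r ] extend X i h * extend (J r r) h j
    ≡⟨ ∑-cong r (λ h h< → trans (cong (extend X i h *_) (extend-J h< j<)) (ℤP.*-identityʳ _)) ⟩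
  ∑[ h < r ] extend X i h                ≡⟨ rowSum i< ⟩
  e                                      ≡⟨ sym (trans (extend-· i< j< e (J m r)) (trans (cong (e *_) (extend-J i< j<)) (ℤP.*-identityʳ e))) ⟩
  extend (e · J m r) i j                 ∎
  where
    open ≡-Reasoning

J⊛-from-colSums : ∀ {m r} {X : Mat m r} {e} → (∀ {j} → j < r → ∑[ h < m ] extend X h j ≡ e) →
                  J m m ⊛ X ≋ e · J m r
J⊛-from-colSums {m} {r} {X} {e} colSum = ≋-extend λ i j i< j< → begin
  extend (J m m ⊛ X) i j                 ≡⟨ extend-⊛ (J m m) X i< j< ⟩
  ∑[ h < m ] extend (J m m) i h * extend X h j
    ≡⟨ ∑-cong m (λ h h< → trans (cong (_* extend X h j) (extend-J i< h<)) (ℤP.*-identityˡ _)) ⟩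
  ∑[ h < m ] extend X h j                ≡⟨ colSum j< ⟩
  e                                      ≡⟨ sym (trans (extend-· i< j< e (J m r)) (trans (cong (e *_) (extend-J i< j<)) (ℤP.*-identityʳ e))) ⟩
  extend (e · J m r) i j                 ∎
  where
    open ≡-Reasoning

extend-zeroOne : ∀ {m n} {X : Mat m n} → ZeroOne X → ∀ {i j} → i < m → j < n → IsZeroOne (extend X i j)
extend-zeroOne {X = X} X01 i< j< = subst IsZeroOne (sym (extend-fromℕ< X i< j<)) (X01 _ _)

count-∑ : ∀ {m} (p : Fin m → Bool) (f : Fin m → ℤ) → (∀ i → IsZeroOne (f i)) →
          + count (λ i → p i ∧ ⌊ f i ℤ.≟ + 1 ⌋) ≡ sumF (λ i → if p i then f i else + 0)
count-∑ {zero}  p f f01 = refl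
count-∑ {suc m} p f f01 = trans
  (ℤP.pos-+ _ (count (λ i → p (Fin.suc i) ∧ ⌊ f (Fin.suc i) ℤ.≟ + 1 ⌋)))
  (cong₂ _+_ (head (p Fin.zero) (f01 Fin.zero))
             (count-∑ (λ i → p (Fin.suc i)) (λ i → f (Fin.suc i)) (λ i → f01 (Fin.suc i))))
  where
    head : ∀ b → IsZeroOne (f Fin.zero) →
           + (if b ∧ ⌊ f Fin.zero ℤ.≟ + 1 ⌋ then 1 else 0) ≡ (if b then f Fin.zero else + 0)
    head false _           = refl
    head true  (inj₁ f≡0) rewrite f≡0 = refl
    head true  (inj₂ f≡1) rewrite f≡1 = refl

-- The matrices P_n

δ-exchange : ∀ {M β β′} → β < M → δ (β ℕ.+ β′) (M ∸ 1) ≡ δ β′ (M ∸ 1 ∸ β)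
δ-exchange {suc M} {β} {β′} (s≤s β≤M) = δ-cong-⇔
  (λ e → trans (sym (ℕP.m+n∸m≡n β β′)) (cong (_∸ β) e))
  (λ e → trans (cong (β ℕ.+_) e) (ℕP.m+[n∸m]≡n β≤M))

exchange-< : ∀ {M} β → 1 ≤ M → M ∸ 1 ∸ β < M
exchange-< {suc M} β _ = s≤s (ℕP.m∸n≤m M β)

-- K_{2M} = K_2 ⊗ K_M
exchange-⊗ : ∀ {M q x ρ β} → q < 2 → x < 2 → ρ < M → β < M →
  δ ((q ℕ.* M ℕ.+ ρ) ℕ.+ (x ℕ.* M ℕ.+ β)) (2 ℕ.* M ∸ 1) ≡ δ (q ℕ.+ x) 1 * δ (ρ ℕ.+ β) (M ∸ 1)
exchange-⊗ {suc M} {q} {x} {ρ} {β} q<2 x<2 (s≤s ρ≤M) (s≤s β≤M) =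
  bits-elim (λ q x → δ ((q ℕ.* suc M ℕ.+ ρ) ℕ.+ (x ℕ.* suc M ℕ.+ β)) (2 ℕ.* suc M ∸ 1)
                     ≡ δ (q ℕ.+ x) 1 * δ (ρ ℕ.+ β) M)
    (trans (δ-≢ (λ e → ℕP.<⇒≢ small (trans e top))) (sym (ℤP.*-zeroˡ (δ (ρ ℕ.+ β) M))))
    (trans (cong₂ δ (shift₀₁ ρ β M) top) (trans (δ-+ˡ (suc M) _ _) (sym (ℤP.*-identityˡ _))))
    (trans (cong₂ δ (shift₁₀ ρ β M) top) (trans (δ-+ˡ (suc M) _ _) (sym (ℤP.*-identityˡ _))))
    (trans (δ-≢ (λ e → ℕP.<⇒≢ big (sym (trans e top)))) (sym (ℤP.*-zeroˡ (δ (ρ ℕ.+ β) M))))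
    q<2 x<2
  where
    top : 2 ℕ.* suc M ∸ 1 ≡ suc M ℕ.+ M
    top = trans (ℕP.+-suc M (M ℕ.+ 0)) (cong (λ z → suc (M ℕ.+ z)) (ℕP.+-identityʳ M))
    small : ρ ℕ.+ β < suc M ℕ.+ M
    small = s≤s (ℕP.+-mono-≤ ρ≤M β≤M)
    big : suc M ℕ.+ M < (1 ℕ.* suc M ℕ.+ ρ) ℕ.+ (1 ℕ.* suc M ℕ.+ β)
    big = subst (_≤ (1 ℕ.* suc M ℕ.+ ρ) ℕ.+ (1 ℕ.* suc M ℕ.+ β)) (double M)
            (ℕP.+-mono-≤ (ℕP.m≤m+n (1 ℕ.* suc M) ρ) (ℕP.m≤m+n (1 ℕ.* suc M) β))
      where
        double : ∀ M → 1 ℕ.* suc M ℕ.+ 1 ℕ.* suc M ≡ suc (suc M ℕ.+ M)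
        double = solve-∀
    shift₀₁ : ∀ ρ β M → ρ ℕ.+ (1 ℕ.* suc M ℕ.+ β) ≡ suc M ℕ.+ (ρ ℕ.+ β)
    shift₀₁ = solve-∀
    shift₁₀ : ∀ ρ β M → (1 ℕ.* suc M ℕ.+ ρ) ℕ.+ β ≡ suc M ℕ.+ (ρ ℕ.+ β)
    shift₁₀ = solve-∀

1≤2^ : ∀ n → 1 ≤ 2 ^ n
1≤2^ n = ℕP.m^n>0 2 n

module P-Properties (t : ℕ) where

  N : ℕ → ℕ
  N n = 2 ^ n

  L : ℕ → ℕ
  L n = N n ℕ.* t

  opaque
    P̂ : ℕ → ℕ → ℕ → ℤ
    P̂ n = extend (PP t n)

    P̂-extend : ∀ n i j → P̂ n i j ≡ extend (PP t n) i j
    P̂-extend n i j = refl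

  dP≡N*L : ∀ n → dP t n ≡ N n ℕ.* L n
  dP≡N*L n = ℕP.*-assoc (N n) (N n) t

  P-entry : ∀ n {α β γ β′ γ′} → α < N n → β < N n → γ < t → β′ < N n → γ′ < L n →
            P̂ n ((α ℕ.* N n ℕ.+ β) ℕ.* t ℕ.+ γ) (β′ ℕ.* L n ℕ.+ γ′) ≡ δ (β ℕ.+ β′) (N n ∸ 1)
  P-entry n {α} {β} {γ} {β′} {γ′} α< β< γ< β′< γ′< = begin
    P̂ n ((α ℕ.* N n ℕ.+ β) ℕ.* t ℕ.+ γ) (β′ ℕ.* L n ℕ.+ γ′)
      ≡⟨ P̂-extend n _ _ ⟩
    extend (PP t n) ((α ℕ.* N n ℕ.+ β) ℕ.* t ℕ.+ γ) (β′ ℕ.* L n ℕ.+ γ′)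
      ≡⟨ cong (λ c → extend (PP t n) ((α ℕ.* N n ℕ.+ β) ℕ.* t ℕ.+ γ) (β′ ℕ.* c ℕ.+ γ′)) (ℕP.*-comm (N n) t) ⟩
    extend (PP t n) ((α ℕ.* N n ℕ.+ β) ℕ.* t ℕ.+ γ) (β′ ℕ.* (t ℕ.* N n) ℕ.+ γ′)
      ≡⟨ extend-castM refl (order (N n)) (J (N n) 1 ⊗ K (N n) ⊗ J t (t ℕ.* N n)) row< col< ⟩
    extend (J (N n) 1 ⊗ K (N n) ⊗ J t (t ℕ.* N n)) _ _
      ≡⟨ extend-⊗ (J (N n) 1 ⊗ K (N n)) (J t (t ℕ.* N n)) (<-⊗ α< β<) γ< β′<1*N γ′<t*N ⟩
    extend (J (N n) 1 ⊗ K (N n)) _ (0 ℕ.* N n ℕ.+ β′) * extend (J t (t ℕ.* N n)) γ γ′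
      ≡⟨ cong₂ _*_ (extend-⊗ (J (N n) 1) (K (N n)) α< β< (s≤s z≤n) β′<) (extend-J γ< γ′<t*N) ⟩
    extend (J (N n) 1) α 0 * extend (K (N n)) β β′ * + 1
      ≡⟨ ℤP.*-identityʳ _ ⟩
    extend (J (N n) 1) α 0 * extend (K (N n)) β β′
      ≡⟨ cong₂ _*_ (extend-J α< (s≤s z≤n)) (extend-K β< β′<) ⟩
    + 1 * δ (β ℕ.+ β′) (N n ∸ 1)
      ≡⟨ ℤP.*-identityˡ _ ⟩
    δ (β ℕ.+ β′) (N n ∸ 1) ∎
    where
      open ≡-Reasoning
      order : ∀ x → (1 ℕ.* x) ℕ.* (t ℕ.* x) ≡ (x ℕ.* x) ℕ.* t
      order x = reorder x t
        where reorder : ∀ x t → (1 ℕ.* x) ℕ.* (t ℕ.* x) ≡ (x ℕ.* x) ℕ.* t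
              reorder = solve-∀
      β′<1*N : β′ < 1 ℕ.* N n
      β′<1*N = subst (β′ <_) (sym (ℕP.*-identityˡ (N n))) β′<
      γ′<t*N : γ′ < t ℕ.* N n
      γ′<t*N = subst (γ′ <_) (ℕP.*-comm (N n) t) γ′<
      row< = <-⊗ (<-⊗ α< β<) γ<
      col< = <-⊗ β′<1*N γ′<t*N

  P-row-indicator : ∀ n {i} → i < dP t n → BlockIndicatorRow (P̂ n) (N n) (L n) i
  P-row-indicator n i< with productIndex {N n ℕ.* N n} {t} i<
  ... | pair αβ< γ< with productIndex {N n} {N n} αβ<
  ...   | pair {y = β} α< β< = N n ∸ 1 ∸ β , exchange-< β (1≤2^ n) ,
                       λ β′< γ′< → trans (P-entry n α< β< γ< β′< γ′<) (δ-exchange β<)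

  P-col-balanced : ∀ n {j} → j < dP t n → BalancedColumn (P̂ n) (N n) (L n) t j
  P-col-balanced n {j} j< {b} b< with productIndex {N n} {L n} (subst (j <_) (dP≡N*L n) j<)
  ... | pair {β′} {γ′} β′< γ′< = begin
    ∑[ γ < L n ] P̂ n (b ℕ.* L n ℕ.+ γ) (β′ ℕ.* L n ℕ.+ γ′)
      ≡⟨ ∑-⊗ (N n) t (λ ρ → δ ρ (N n ∸ 1 ∸ β′)) (λ _ → + 1)
             (λ ρ g ρ< g< → trans (cong (λ r → P̂ n r (β′ ℕ.* L n ℕ.+ γ′)) (reindex b ρ g))
                           (trans (P-entry n b< ρ< g< β′< γ′<)
                           (trans (trans (cong (λ x → δ x (N n ∸ 1)) (ℕP.+-comm ρ β′)) (δ-exchange β′<))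
                                  (sym (ℤP.*-identityʳ _))))) ⟩
    (∑[ ρ < N n ] δ ρ (N n ∸ 1 ∸ β′)) * (∑[ _ < t ] + 1)
      ≡⟨ cong₂ _*_ (trans (∑-cong (N n) (λ ρ _ → sym (ℤP.*-identityʳ _)))
                          (∑-δ (N n) (λ _ → + 1) (exchange-< β′ (1≤2^ n))))
                   (∑-const t (+ 1)) ⟩
    + 1 * (+ t * + 1)
      ≡⟨ trans (ℤP.*-identityˡ _) (ℤP.*-identityʳ (+ t)) ⟩
    + t ∎
    where
      open ≡-Reasoning
      reindex : ∀ b ρ g → b ℕ.* L n ℕ.+ (ρ ℕ.* t ℕ.+ g) ≡ (b ℕ.* N n ℕ.+ ρ) ℕ.* t ℕ.+ g
      reindex b ρ g = reassoc b (N n) t ρ g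
        where reassoc : ∀ b N t ρ g → b ℕ.* (N ℕ.* t) ℕ.+ (ρ ℕ.* t ℕ.+ g) ≡ (b ℕ.* N ℕ.+ ρ) ℕ.* t ℕ.+ g
              reassoc = solve-∀

  P-suc-entry : ∀ n {p q r x y z} → p < 2 ℕ.* N n → q < 2 → r < L n → x < 2 → y < dP t n → z < 2 →
    P̂ (suc n) ((p ℕ.* 2 ℕ.+ q) ℕ.* L n ℕ.+ r) ((x ℕ.* dP t n ℕ.+ y) ℕ.* 2 ℕ.+ z) ≡ δ q (1 ∸ x) * P̂ n r y
  P-suc-entry n {p} {q} {r} {x} {y} {z} p< q< r< x< y< z<
    with productIndex {N n} {t} r< | productIndex {N n} {L n} (subst (y <_) (dP≡N*L n) y<)
  ... | pair {ρ} {γ} ρ< γ< | pair {β′} {γ′} β′< γ′< = begin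
    P̂ (suc n) ((p ℕ.* 2 ℕ.+ q) ℕ.* L n ℕ.+ (ρ ℕ.* t ℕ.+ γ))
              ((x ℕ.* dP t n ℕ.+ (β′ ℕ.* L n ℕ.+ γ′)) ℕ.* 2 ℕ.+ z)
      ≡⟨ cong₂ (P̂ (suc n)) (row≡ p q (N n) t ρ γ) (col≡ x (N n) t β′ γ′ z) ⟩
    P̂ (suc n) ((p ℕ.* N (suc n) ℕ.+ (q ℕ.* N n ℕ.+ ρ)) ℕ.* t ℕ.+ γ)
              ((x ℕ.* N n ℕ.+ β′) ℕ.* L (suc n) ℕ.+ (γ′ ℕ.* 2 ℕ.+ z))
      ≡⟨ P-entry (suc n) p< (<-⊗ q< ρ<) γ< (<-⊗ x< β′<) γ′2z< ⟩
    δ ((q ℕ.* N n ℕ.+ ρ) ℕ.+ (x ℕ.* N n ℕ.+ β′)) (N (suc n) ∸ 1)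
      ≡⟨ exchange-⊗ q< x< ρ< β′< ⟩
    δ (q ℕ.+ x) 1 * δ (ρ ℕ.+ β′) (N n ∸ 1)
      ≡⟨ cong₂ _*_ (trans (δ-K₂ˡ q< x<) (δ-flip q< x<)) (sym (P-entry n {α = 0} (1≤2^ n) ρ< γ< β′< γ′<)) ⟩
    δ q (1 ∸ x) * P̂ n (ρ ℕ.* t ℕ.+ γ) (β′ ℕ.* L n ℕ.+ γ′) ∎
    where
      open ≡-Reasoning
      row≡ : ∀ p q N t ρ γ → (p ℕ.* 2 ℕ.+ q) ℕ.* (N ℕ.* t) ℕ.+ (ρ ℕ.* t ℕ.+ γ)
                           ≡ (p ℕ.* (2 ℕ.* N) ℕ.+ (q ℕ.* N ℕ.+ ρ)) ℕ.* t ℕ.+ γ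
      row≡ = solve-∀
      col≡ : ∀ x N t β γ z → (x ℕ.* ((N ℕ.* N) ℕ.* t) ℕ.+ (β ℕ.* (N ℕ.* t) ℕ.+ γ)) ℕ.* 2 ℕ.+ z
                           ≡ (x ℕ.* N ℕ.+ β) ℕ.* ((2 ℕ.* N) ℕ.* t) ℕ.+ (γ ℕ.* 2 ℕ.+ z)
      col≡ = solve-∀
      γ′2z< : γ′ ℕ.* 2 ℕ.+ z < L (suc n)
      γ′2z< = subst (γ′ ℕ.* 2 ℕ.+ z <_) (double (N n) t) (<-⊗ γ′< z<)
        where double : ∀ N t → (N ℕ.* t) ℕ.* 2 ≡ (2 ℕ.* N) ℕ.* t
              double = solve-∀

  P-zeroOne : ∀ n {i j} → i < dP t n → j < dP t n → IsZeroOne (P̂ n i j)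
  P-zeroOne n {j = j} i< j< = indicator-zeroOne {X = P̂ n} (P-row-indicator n i<) (subst (j <_) (dP≡N*L n) j<)

-- The construction

module Development (v t : ℕ) (k lm : ℤ) (A₁ : Mat v v) (B₁ : Mat v (4 ℕ.* t)) (C₁ : Mat (4 ℕ.* t) v) where

  open Construction v t A₁ B₁ C₁
  open P-Properties t

  s : ℤ
  s = + t - lm

  k′ : ℕ → ℤ
  k′ n = k + + ((2 ^ n ∸ 2) ℕ.* t)

  -- Opaque (like P̂), so that with-abstraction over indices does not unfold the matrices.
  opaque
    Â B̂ Ĉ : ℕ → ℕ → ℕ → ℤ
    Â n = extend (A n)
    B̂ n = extend (B n)
    Ĉ n = extend (C n)

  Law : (m l r : ℕ) (X Y Z : ℕ → ℕ → ℤ) → Set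
  Law m l r X Y Z = ∀ {i j} → i < m → j < r → (∑[ h < l ] X i h * Y h j) + s * Z i j ≡ + t

  ConstProduct : (m l r : ℕ) (X Y : ℕ → ℕ → ℤ) → Set
  ConstProduct m l r X Y = ∀ {i j} → i < m → j < r → ∑[ h < l ] X i h * Y h j ≡ + t

  record Invariant (n : ℕ) : Set where
    field
      A-zeroOne : ∀ {i j} → i < a n → j < a n → IsZeroOne (Â n i j)
      C-zeroOne : ∀ {i j} → i < d n → j < a n → IsZeroOne (Ĉ n i j)
      A-diag    : ∀ {i} → i < a n → Â n i i ≡ + 0
      A-rowSum  : ∀ {i} → i < a n → ∑[ h < a n ] Â n i h ≡ k′ n
      A-colSum  : ∀ {j} → j < a n → ∑[ h < a n ] Â n h j ≡ k′ n
      B-colSum  : ∀ {j} → j < d n → ∑[ h < a n ] B̂ n h j ≡ k′ n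
      C-rowSum  : ∀ {i} → i < d n → ∑[ h < a n ] Ĉ n i h ≡ k′ n
      B-rows    : ∀ {i} → i < a n → BlockIndicatorRow (B̂ n) (N n) (L n) i
      C-cols    : ∀ {j} → j < a n → BalancedColumn (Ĉ n) (N n) (L n) t j
      AA-law : Law (a n) (a n) (a n) (Â n) (Â n) (Â n)
      AB-law : Law (a n) (a n) (d n) (Â n) (B̂ n) (B̂ n)
      CA-law : Law (d n) (a n) (a n) (Ĉ n) (Â n) (Ĉ n)
      CB-law : Law (d n) (a n) (d n) (Ĉ n) (B̂ n) (P̂ n)

  module Consequences {n : ℕ} (inv : Invariant n) where
    open Invariant inv

    ∑-d : ∀ (f : ℕ → ℤ) → ∑< (d n) f ≡ ∑< (N n ℕ.* L n) f
    ∑-d f = cong (λ m → ∑< m f) (dP≡N*L n)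

    B-zeroOne : ∀ {i j} → i < a n → j < d n → IsZeroOne (B̂ n i j)
    B-zeroOne {j = j} i< j< = indicator-zeroOne {X = B̂ n} (B-rows i<) (subst (j <_) (dP≡N*L n) j<)

    BC-const : ConstProduct (a n) (d n) (a n) (B̂ n) (Ĉ n)
    BC-const i< j< = trans (∑-d _) (indicator-balanced-∑ {X = B̂ n} {Y = Ĉ n} (B-rows i<) (C-cols j<))

    BP-const : ConstProduct (a n) (d n) (d n) (B̂ n) (P̂ n)
    BP-const i< j< = trans (∑-d _) (indicator-balanced-∑ {X = B̂ n} {Y = P̂ n} (B-rows i<) (P-col-balanced n j<))

    PC-const : ConstProduct (d n) (d n) (a n) (P̂ n) (Ĉ n)
    PC-const i< j< = trans (∑-d _) (indicator-balanced-∑ {X = P̂ n} {Y = Ĉ n} (P-row-indicator n i<) (C-cols j<))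

    PP-const : ConstProduct (d n) (d n) (d n) (P̂ n) (P̂ n)
    PP-const i< j< = trans (∑-d _) (indicator-balanced-∑ {X = P̂ n} {Y = P̂ n} (P-row-indicator n i<) (P-col-balanced n j<))

    B-rowSum : ∀ {i} → i < a n → ∑[ h < d n ] B̂ n i h ≡ + L n
    B-rowSum i< = trans (∑-d _) (indicator-∑ {X = B̂ n} (B-rows i<))

    P-rowSum : ∀ {i} → i < d n → ∑[ h < d n ] P̂ n i h ≡ + L n
    P-rowSum i< = trans (∑-d _) (indicator-∑ {X = P̂ n} (P-row-indicator n i<))

    C-colSum : ∀ {j} → j < a n → ∑[ h < d n ] Ĉ n h j ≡ + L n
    C-colSum j< = trans (∑-d _) (balanced-∑ {Y = Ĉ n} (C-cols j<))

    P-colSum : ∀ {j} → j < d n → ∑[ h < d n ] P̂ n h j ≡ + L n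
    P-colSum j< = trans (∑-d _) (balanced-∑ {Y = P̂ n} (P-col-balanced n j<))

  module Step (m : ℕ) (inv : Invariant (suc m)) where
    open Invariant inv
    open Consequences inv

    n : ℕ
    n = suc m

    opaque
      unfolding Â B̂ Ĉ P̂

      Y₁ : Mat ((2 ℕ.* a n) ℕ.* 1) ((2 ℕ.* d n) ℕ.* 2)
      Y₁ = K 2 ⊗ B n ⊗ J 1 2

      Y₂ : Mat ((2 ℕ.* d n) ℕ.* 1) ((2 ℕ.* d n) ℕ.* 2)
      Y₂ = I 2 ⊗ P n ⊗ J 1 2

      B-rows≡ : (2 ℕ.* a n) ℕ.* 1 ℕ.+ (2 ℕ.* d n) ℕ.* 1 ≡ a (suc n)
      B-rows≡ = cong₂ ℕ._+_ (ℕP.*-identityʳ (2 ℕ.* a n)) (ℕP.*-identityʳ (2 ℕ.* d n))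

      B-cols≡ : (2 ℕ.* d n) ℕ.* 2 ≡ d (suc n)
      B-cols≡ = regroup (N n) t
        where regroup : ∀ x t → (2 ℕ.* ((x ℕ.* x) ℕ.* t)) ℕ.* 2 ≡ ((2 ℕ.* x) ℕ.* (2 ℕ.* x)) ℕ.* t
              regroup = solve-∀

      A-entry₁₁ : ∀ {u y w y′} → u < 2 → y < a n → w < 2 → y′ < a n →
        Â (suc n) (u ℕ.* a n ℕ.+ y) (w ℕ.* a n ℕ.+ y′) ≡ δ u w * Â n y y′
      A-entry₁₁ u< y< w< y′< = trans
        (extend-block₁₁ (I 2 ⊗ A n) (I 2 ⊗ B n) (K 2 ⊗ C n) (K 2 ⊗ P n) (<-⊗ u< y<) (<-⊗ w< y′<))
        (extend-I₂⊗ (A n) u< w< y< y′<)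

      A-entry₁₂ : ∀ {u y w y′} → u < 2 → y < a n → w < 2 → y′ < d n →
        Â (suc n) (u ℕ.* a n ℕ.+ y) (2 ℕ.* a n ℕ.+ (w ℕ.* d n ℕ.+ y′)) ≡ δ u w * B̂ n y y′
      A-entry₁₂ u< y< w< y′< = trans
        (extend-block₁₂ (I 2 ⊗ A n) (I 2 ⊗ B n) (K 2 ⊗ C n) (K 2 ⊗ P n) (<-⊗ u< y<) (<-⊗ w< y′<))
        (extend-I₂⊗ (B n) u< w< y< y′<)

      A-entry₂₁ : ∀ {u y w y′} → u < 2 → y < d n → w < 2 → y′ < a n →
        Â (suc n) (2 ℕ.* a n ℕ.+ (u ℕ.* d n ℕ.+ y)) (w ℕ.* a n ℕ.+ y′) ≡ δ (1 ∸ u) w * Ĉ n y y′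
      A-entry₂₁ u< y< w< y′< = trans
        (extend-block₂₁ (I 2 ⊗ A n) (I 2 ⊗ B n) (K 2 ⊗ C n) (K 2 ⊗ P n) (<-⊗ u< y<) (<-⊗ w< y′<))
        (extend-K₂⊗ (C n) u< w< y< y′<)

      A-entry₂₂ : ∀ {u y w y′} → u < 2 → y < d n → w < 2 → y′ < d n →
        Â (suc n) (2 ℕ.* a n ℕ.+ (u ℕ.* d n ℕ.+ y)) (2 ℕ.* a n ℕ.+ (w ℕ.* d n ℕ.+ y′)) ≡ δ (1 ∸ u) w * P̂ n y y′
      A-entry₂₂ u< y< w< y′< = trans
        (extend-block₂₂ (I 2 ⊗ A n) (I 2 ⊗ B n) (K 2 ⊗ C n) (K 2 ⊗ P n) (<-⊗ u< y<) (<-⊗ w< y′<))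
        (extend-K₂⊗ (P n) u< w< y< y′<)

      B-entry₁ : ∀ {u y x y′ z} → u < 2 → y < a n → x < 2 → y′ < d n → z < 2 →
        B̂ (suc n) (u ℕ.* a n ℕ.+ y) ((x ℕ.* d n ℕ.+ y′) ℕ.* 2 ℕ.+ z) ≡ δ u (1 ∸ x) * B̂ n y y′
      B-entry₁ {u} {y} {x} {y′} {z} u< y< x< y′< z< = begin
        B̂ (suc n) (u ℕ.* a n ℕ.+ y) ((x ℕ.* d n ℕ.+ y′) ℕ.* 2 ℕ.+ z)
          ≡⟨ extend-castM B-rows≡ B-cols≡ (vcat Y₁ Y₂) (ℕP.<-≤-trans row< (ℕP.m≤m+n _ _)) col< ⟩
        extend (vcat Y₁ Y₂) (u ℕ.* a n ℕ.+ y) ((x ℕ.* d n ℕ.+ y′) ℕ.* 2 ℕ.+ z)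
          ≡⟨ extend-vcatˡ Y₁ Y₂ col< row< ⟩
        extend Y₁ (u ℕ.* a n ℕ.+ y) ((x ℕ.* d n ℕ.+ y′) ℕ.* 2 ℕ.+ z)
          ≡⟨ extend-⊗J (K 2 ⊗ B n) (<-⊗ u< y<) (<-⊗ x< y′<) z< ⟩
        extend (K 2 ⊗ B n) (u ℕ.* a n ℕ.+ y) (x ℕ.* d n ℕ.+ y′)
          ≡⟨ extend-K₂⊗ (B n) u< x< y< y′< ⟩
        δ (1 ∸ u) x * B̂ n y y′
          ≡⟨ cong (_* B̂ n y y′) (δ-flip u< x<) ⟩
        δ u (1 ∸ x) * B̂ n y y′ ∎
        where
          open ≡-Reasoning
          row< : u ℕ.* a n ℕ.+ y < (2 ℕ.* a n) ℕ.* 1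
          row< = subst (u ℕ.* a n ℕ.+ y <_) (sym (ℕP.*-identityʳ _)) (<-⊗ u< y<)
          col< : (x ℕ.* d n ℕ.+ y′) ℕ.* 2 ℕ.+ z < (2 ℕ.* d n) ℕ.* 2
          col< = <-⊗ (<-⊗ x< y′<) z<

      B-entry₂ : ∀ {u y x y′ z} → u < 2 → y < d n → x < 2 → y′ < d n → z < 2 →
        B̂ (suc n) (2 ℕ.* a n ℕ.+ (u ℕ.* d n ℕ.+ y)) ((x ℕ.* d n ℕ.+ y′) ℕ.* 2 ℕ.+ z)
          ≡ δ (1 ∸ u) (1 ∸ x) * P̂ n y y′
      B-entry₂ {u} {y} {x} {y′} {z} u< y< x< y′< z< = begin
        B̂ (suc n) (2 ℕ.* a n ℕ.+ (u ℕ.* d n ℕ.+ y)) ((x ℕ.* d n ℕ.+ y′) ℕ.* 2 ℕ.+ z)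
          ≡⟨ cong (λ r → B̂ (suc n) (r ℕ.+ (u ℕ.* d n ℕ.+ y)) ((x ℕ.* d n ℕ.+ y′) ℕ.* 2 ℕ.+ z))
                  (sym (ℕP.*-identityʳ (2 ℕ.* a n))) ⟩
        B̂ (suc n) ((2 ℕ.* a n) ℕ.* 1 ℕ.+ (u ℕ.* d n ℕ.+ y)) ((x ℕ.* d n ℕ.+ y′) ℕ.* 2 ℕ.+ z)
          ≡⟨ extend-castM B-rows≡ B-cols≡ (vcat Y₁ Y₂) (ℕP.+-monoʳ-< ((2 ℕ.* a n) ℕ.* 1) row<) col< ⟩
        extend (vcat Y₁ Y₂) ((2 ℕ.* a n) ℕ.* 1 ℕ.+ (u ℕ.* d n ℕ.+ y)) ((x ℕ.* d n ℕ.+ y′) ℕ.* 2 ℕ.+ z)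
          ≡⟨ extend-vcatʳ Y₁ Y₂ col< row< ⟩
        extend Y₂ (u ℕ.* d n ℕ.+ y) ((x ℕ.* d n ℕ.+ y′) ℕ.* 2 ℕ.+ z)
          ≡⟨ extend-⊗J (I 2 ⊗ P n) (<-⊗ u< y<) (<-⊗ x< y′<) z< ⟩
        extend (I 2 ⊗ P n) (u ℕ.* d n ℕ.+ y) (x ℕ.* d n ℕ.+ y′)
          ≡⟨ extend-I₂⊗ (P n) u< x< y< y′< ⟩
        δ u x * P̂ n y y′
          ≡⟨ cong (_* P̂ n y y′) (δ-∸∸ u< x<) ⟩
        δ (1 ∸ u) (1 ∸ x) * P̂ n y y′ ∎
        where
          open ≡-Reasoning
          row< : u ℕ.* d n ℕ.+ y < (2 ℕ.* d n) ℕ.* 1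
          row< = subst (u ℕ.* d n ℕ.+ y <_) (sym (ℕP.*-identityʳ _)) (<-⊗ u< y<)
          col< : (x ℕ.* d n ℕ.+ y′) ℕ.* 2 ℕ.+ z < (2 ℕ.* d n) ℕ.* 2
          col< = <-⊗ (<-⊗ x< y′<) z<

      R : ℕ
      R = _/_ (d n) (N n) {{2^nz n}}

      R≡L : R ≡ L n
      R≡L = trans (cong (λ x → _/_ x (N n) {{2^nz n}}) (regroup (N n) t)) (m*n/n≡m (L n) (N n) {{2^nz n}})
        where regroup : ∀ x t → (x ℕ.* x) ℕ.* t ≡ (x ℕ.* t) ℕ.* x
              regroup = solve-∀

      Z₁ : Mat ((N (suc n) ℕ.* 2) ℕ.* R) (2 ℕ.* a n)
      Z₁ = J (N (suc n)) 1 ⊗ I 2 ⊗ α (N n) {{2^nz n}} (C n)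

      Z₂ : Mat ((N (suc n) ℕ.* 2) ℕ.* R) (2 ℕ.* d n)
      Z₂ = J (N (suc n)) 1 ⊗ I 2 ⊗ α (N n) {{2^nz n}} (P n)

      C-rows≡ : (N (suc n) ℕ.* 2) ℕ.* R ≡ d (suc n)
      C-rows≡ = trans (cong ((N (suc n) ℕ.* 2) ℕ.*_) R≡L) (regroup (N n) t)
        where regroup : ∀ x t → ((2 ℕ.* x) ℕ.* 2) ℕ.* (x ℕ.* t) ≡ ((2 ℕ.* x) ℕ.* (2 ℕ.* x)) ℕ.* t
              regroup = solve-∀

      C-entry₁ : ∀ {p q r w y} → p < 2 ℕ.* N n → q < 2 → r < L n → w < 2 → y < a n →
        Ĉ (suc n) ((p ℕ.* 2 ℕ.+ q) ℕ.* L n ℕ.+ r) (w ℕ.* a n ℕ.+ y) ≡ δ q w * Ĉ n r y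
      C-entry₁ {p} {q} {r} {w} {y} p< q< r< w< y< = begin
        Ĉ (suc n) ((p ℕ.* 2 ℕ.+ q) ℕ.* L n ℕ.+ r) (w ℕ.* a n ℕ.+ y)
          ≡⟨ cong (λ l → Ĉ (suc n) ((p ℕ.* 2 ℕ.+ q) ℕ.* l ℕ.+ r) (w ℕ.* a n ℕ.+ y)) (sym R≡L) ⟩
        Ĉ (suc n) ((p ℕ.* 2 ℕ.+ q) ℕ.* R ℕ.+ r) (w ℕ.* a n ℕ.+ y)
          ≡⟨ extend-castM C-rows≡ refl (hcat Z₁ Z₂) row< (ℕP.<-≤-trans (<-⊗ w< y<) (ℕP.m≤m+n _ _)) ⟩
        extend (hcat Z₁ Z₂) ((p ℕ.* 2 ℕ.+ q) ℕ.* R ℕ.+ r) (w ℕ.* a n ℕ.+ y)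
          ≡⟨ extend-hcatˡ Z₁ Z₂ row< (<-⊗ w< y<) ⟩
        extend Z₁ ((p ℕ.* 2 ℕ.+ q) ℕ.* R ℕ.+ r) (w ℕ.* a n ℕ.+ y)
          ≡⟨ extend-⊗ (J (N (suc n)) 1 ⊗ I 2) (α (N n) {{2^nz n}} (C n)) (<-⊗ p< q<) r<R w< y< ⟩
        extend (J (N (suc n)) 1 ⊗ I 2) (p ℕ.* 2 ℕ.+ q) w * extend (α (N n) {{2^nz n}} (C n)) r y
          ≡⟨ cong₂ _*_ (extend-J⊗I₂ p< q< w<) (extend-α (N n) {{2^nz n}} (C n) r<R y<) ⟩
        δ q w * Ĉ n r y ∎
        where
          open ≡-Reasoning
          r<R : r < R
          r<R = subst (r <_) (sym R≡L) r<
          row< : (p ℕ.* 2 ℕ.+ q) ℕ.* R ℕ.+ r < (N (suc n) ℕ.* 2) ℕ.* R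
          row< = <-⊗ (<-⊗ p< q<) r<R

      C-entry₂ : ∀ {p q r w y} → p < 2 ℕ.* N n → q < 2 → r < L n → w < 2 → y < d n →
        Ĉ (suc n) ((p ℕ.* 2 ℕ.+ q) ℕ.* L n ℕ.+ r) (2 ℕ.* a n ℕ.+ (w ℕ.* d n ℕ.+ y)) ≡ δ q w * P̂ n r y
      C-entry₂ {p} {q} {r} {w} {y} p< q< r< w< y< = begin
        Ĉ (suc n) ((p ℕ.* 2 ℕ.+ q) ℕ.* L n ℕ.+ r) (2 ℕ.* a n ℕ.+ (w ℕ.* d n ℕ.+ y))
          ≡⟨ cong (λ l → Ĉ (suc n) ((p ℕ.* 2 ℕ.+ q) ℕ.* l ℕ.+ r) (2 ℕ.* a n ℕ.+ (w ℕ.* d n ℕ.+ y))) (sym R≡L) ⟩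
        Ĉ (suc n) ((p ℕ.* 2 ℕ.+ q) ℕ.* R ℕ.+ r) (2 ℕ.* a n ℕ.+ (w ℕ.* d n ℕ.+ y))
          ≡⟨ extend-castM C-rows≡ refl (hcat Z₁ Z₂) row< (ℕP.+-monoʳ-< (2 ℕ.* a n) (<-⊗ w< y<)) ⟩
        extend (hcat Z₁ Z₂) ((p ℕ.* 2 ℕ.+ q) ℕ.* R ℕ.+ r) (2 ℕ.* a n ℕ.+ (w ℕ.* d n ℕ.+ y))
          ≡⟨ extend-hcatʳ Z₁ Z₂ row< (<-⊗ w< y<) ⟩
        extend Z₂ ((p ℕ.* 2 ℕ.+ q) ℕ.* R ℕ.+ r) (w ℕ.* d n ℕ.+ y)
          ≡⟨ extend-⊗ (J (N (suc n)) 1 ⊗ I 2) (α (N n) {{2^nz n}} (P n)) (<-⊗ p< q<) r<R w< y< ⟩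
        extend (J (N (suc n)) 1 ⊗ I 2) (p ℕ.* 2 ℕ.+ q) w * extend (α (N n) {{2^nz n}} (P n)) r y
          ≡⟨ cong₂ _*_ (extend-J⊗I₂ p< q< w<) (extend-α (N n) {{2^nz n}} (P n) r<R y<) ⟩
        δ q w * P̂ n r y ∎
        where
          open ≡-Reasoning
          r<R : r < R
          r<R = subst (r <_) (sym R≡L) r<
          row< : (p ℕ.* 2 ℕ.+ q) ℕ.* R ℕ.+ r < (N (suc n) ℕ.* 2) ℕ.* R
          row< = <-⊗ (<-⊗ p< q<) r<R

    k′-suc : k′ (suc n) ≡ k′ n + + L n
    k′-suc = begin
      k + + ((2 ℕ.* N n ∸ 2) ℕ.* t)
        ≡⟨ cong (λ x → k + + (x ℕ.* t)) double∸2 ⟩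
      k + + ((N n ∸ 2 ℕ.+ N n) ℕ.* t)
        ≡⟨ cong (λ x → k + + x) (ℕP.*-distribʳ-+ t (N n ∸ 2) (N n)) ⟩
      k + + ((N n ∸ 2) ℕ.* t ℕ.+ L n)
        ≡⟨ cong (_+_ k) (ℤP.pos-+ ((N n ∸ 2) ℕ.* t) (L n)) ⟩
      k + (+ ((N n ∸ 2) ℕ.* t) + + L n)
        ≡⟨ sym (ℤP.+-assoc k _ _) ⟩
      k′ n + + L n ∎
      where
        open ≡-Reasoning
        2≤N : 2 ≤ N n
        2≤N = ℕP.*-monoʳ-≤ 2 (1≤2^ m)
        double∸2 : 2 ℕ.* N n ∸ 2 ≡ N n ∸ 2 ℕ.+ N n
        double∸2 = trans (cong (_∸ 2) (cong (N n ℕ.+_) (ℕP.+-identityʳ (N n)))) (ℕP.+-∸-comm (N n) 2≤N)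

    k′-step : ∀ {S S′} → S ≡ k′ n → S′ ≡ + L n → S + S′ ≡ k′ (suc n)
    k′-step S≡ S′≡ = trans (cong₂ _+_ S≡ S′≡) (sym k′-suc)

    L≤d : L n ≤ d n
    L≤d = subst (L n ≤_) (sym (dP≡N*L n)) (ℕP.m≤n*m (L n) (N n) {{2^nz n}})

    rowA↑ : ∀ {u y} → u < 2 → y < a n →
            RowShape (a n) (d n) (Â (suc n) (u ℕ.* a n ℕ.+ y)) u (Â n y) (B̂ n y)
    rowA↑ u< y< = record { shape<2 = u< ; on-front = A-entry₁₁ u< y< ; on-back = A-entry₁₂ u< y< }

    rowA↓ : ∀ {u y} → u < 2 → y < d n →
            RowShape (a n) (d n) (Â (suc n) (2 ℕ.* a n ℕ.+ (u ℕ.* d n ℕ.+ y))) (1 ∸ u) (Ĉ n y) (P̂ n y)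
    rowA↓ {u} u< y< = record { shape<2 = 1∸-<2 u ; on-front = A-entry₂₁ u< y< ; on-back = A-entry₂₂ u< y< }

    rowC : ∀ {p q r} → p < 2 ℕ.* N n → q < 2 → r < L n →
           RowShape (a n) (d n) (Ĉ (suc n) ((p ℕ.* 2 ℕ.+ q) ℕ.* L n ℕ.+ r)) q (Ĉ n r) (P̂ n r)
    rowC p< q< r< = record { shape<2 = q< ; on-front = C-entry₁ p< q< r< ; on-back = C-entry₂ p< q< r< }

    colA← : ∀ {u y} → u < 2 → y < a n →
            ColShape (a n) (d n) (λ l → Â (suc n) l (u ℕ.* a n ℕ.+ y)) u (λ l → Â n l y) (λ l → Ĉ n l y)
    colA← u< y< = record { shape<2 = u<
                         ; on-front = λ w< y′< → A-entry₁₁ w< y′< u< y<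
                         ; on-back  = λ w< y′< → A-entry₂₁ w< y′< u< y< }

    colA→ : ∀ {u y} → u < 2 → y < d n →
            ColShape (a n) (d n) (λ l → Â (suc n) l (2 ℕ.* a n ℕ.+ (u ℕ.* d n ℕ.+ y))) u (λ l → B̂ n l y) (λ l → P̂ n l y)
    colA→ u< y< = record { shape<2 = u<
                         ; on-front = λ w< y′< → A-entry₁₂ w< y′< u< y<
                         ; on-back  = λ w< y′< → A-entry₂₂ w< y′< u< y< }

    colB : ∀ {x y z} → x < 2 → y < d n → z < 2 →
           ColShape (a n) (d n) (λ l → B̂ (suc n) l ((x ℕ.* d n ℕ.+ y) ℕ.* 2 ℕ.+ z)) (1 ∸ x) (λ l → B̂ n l y) (λ l → P̂ n l y)
    colB {x} x< y< z< = record { shape<2 = 1∸-<2 x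
                               ; on-front = λ w< y′< → B-entry₁ w< y′< x< y< z<
                               ; on-back  = λ w< y′< → B-entry₂ w< y′< x< y< z< }

    B-colIndex : ∀ {j} → j < d (suc n) → NestedIndex 2 (d n) 2 j
    B-colIndex {j} j< = nestedIndex (subst (j <_) (sym B-cols≡) j<)

    C-rowIndex : ∀ {i} → i < d (suc n) → NestedIndex (2 ℕ.* N n) 2 (L n) i
    C-rowIndex {i} i< = nestedIndex (subst (i <_) (regroup (N n) t) i<)
      where regroup : ∀ x t → ((2 ℕ.* x) ℕ.* (2 ℕ.* x)) ℕ.* t ≡ ((2 ℕ.* x) ℕ.* 2) ℕ.* (x ℕ.* t)
            regroup = solve-∀

    AA-law′ : Law (a (suc n)) (a (suc n)) (a (suc n)) (Â (suc n)) (Â (suc n)) (Â (suc n))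
    AA-law′ i< j< with blockIndex (a n) (d n) i< | blockIndex (a n) (d n) j<
    ... | front u< y< | front w< y′< =
      shapes-law s (+ t) (rowA↑ u< y<) (colA← w< y′<) (A-entry₁₁ u< y< w< y′<) (AA-law y< y′<) (BC-const y< y′<)
    ... | front u< y< | back w< y′< =
      shapes-law s (+ t) (rowA↑ u< y<) (colA→ w< y′<) (A-entry₁₂ u< y< w< y′<) (AB-law y< y′<) (BP-const y< y′<)
    ... | back u< y< | front w< y′< =
      shapes-law s (+ t) (rowA↓ u< y<) (colA← w< y′<) (A-entry₂₁ u< y< w< y′<) (CA-law y< y′<) (PC-const y< y′<)
    ... | back u< y< | back w< y′< =
      shapes-law s (+ t) (rowA↓ u< y<) (colA→ w< y′<) (A-entry₂₂ u< y< w< y′<) (CB-law y< y′<) (PP-const y< y′<)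

    AB-law′ : Law (a (suc n)) (a (suc n)) (d (suc n)) (Â (suc n)) (B̂ (suc n)) (B̂ (suc n))
    AB-law′ i< j< with blockIndex (a n) (d n) i< | B-colIndex j<
    ... | front u< y< | triple x< y′< z< =
      shapes-law s (+ t) (rowA↑ u< y<) (colB x< y′< z<) (B-entry₁ u< y< x< y′< z<) (AB-law y< y′<) (BP-const y< y′<)
    ... | back u< y< | triple x< y′< z< =
      shapes-law s (+ t) (rowA↓ u< y<) (colB x< y′< z<) (B-entry₂ u< y< x< y′< z<) (CB-law y< y′<) (PP-const y< y′<)

    r<d : ∀ {r} → r < L n → r < d n
    r<d r< = ℕP.<-≤-trans r< L≤d

    CA-law′ : Law (d (suc n)) (a (suc n)) (a (suc n)) (Ĉ (suc n)) (Â (suc n)) (Ĉ (suc n))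
    CA-law′ i< j< with C-rowIndex i< | blockIndex (a n) (d n) j<
    ... | triple p< q< r< | front w< y′< =
      shapes-law s (+ t) (rowC p< q< r<) (colA← w< y′<) (C-entry₁ p< q< r< w< y′<) (CA-law (r<d r<) y′<) (PC-const (r<d r<) y′<)
    ... | triple p< q< r< | back w< y′< =
      shapes-law s (+ t) (rowC p< q< r<) (colA→ w< y′<) (C-entry₂ p< q< r< w< y′<) (CB-law (r<d r<) y′<) (PP-const (r<d r<) y′<)

    CB-law′ : Law (d (suc n)) (a (suc n)) (d (suc n)) (Ĉ (suc n)) (B̂ (suc n)) (P̂ (suc n))
    CB-law′ i< j< with C-rowIndex i< | B-colIndex j<
    ... | triple p< q< r< | triple x< y′< z< =
      shapes-law s (+ t) (rowC p< q< r<) (colB x< y′< z<) (P-suc-entry n p< q< r< x< y′< z<)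
                 (CB-law (r<d r<) y′<) (PP-const (r<d r<) y′<)

    A-rowSum′ : ∀ {i} → i < a (suc n) → ∑[ h < a (suc n) ] Â (suc n) i h ≡ k′ (suc n)
    A-rowSum′ i< with blockIndex (a n) (d n) i<
    ... | front u< y< = trans (rowShape-∑ (rowA↑ u< y<)) (k′-step (A-rowSum y<) (B-rowSum y<))
    ... | back u< y<  = trans (rowShape-∑ (rowA↓ u< y<)) (k′-step (C-rowSum y<) (P-rowSum y<))

    A-colSum′ : ∀ {j} → j < a (suc n) → ∑[ h < a (suc n) ] Â (suc n) h j ≡ k′ (suc n)
    A-colSum′ j< with blockIndex (a n) (d n) j<
    ... | front u< y< = trans (colShape-∑ (colA← u< y<)) (k′-step (A-colSum y<) (C-colSum y<))
    ... | back u< y<  = trans (colShape-∑ (colA→ u< y<)) (k′-step (B-colSum y<) (P-colSum y<))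

    B-colSum′ : ∀ {j} → j < d (suc n) → ∑[ h < a (suc n) ] B̂ (suc n) h j ≡ k′ (suc n)
    B-colSum′ j< with B-colIndex j<
    ... | triple x< y< z< = trans (colShape-∑ (colB x< y< z<)) (k′-step (B-colSum y<) (P-colSum y<))

    C-rowSum′ : ∀ {i} → i < d (suc n) → ∑[ h < a (suc n) ] Ĉ (suc n) i h ≡ k′ (suc n)
    C-rowSum′ i< with C-rowIndex i<
    ... | triple p< q< r< = trans (rowShape-∑ (rowC p< q< r<)) (k′-step (C-rowSum (r<d r<)) (P-rowSum (r<d r<)))

    A-diag′ : ∀ {i} → i < a (suc n) → Â (suc n) i i ≡ + 0
    A-diag′ i< with blockIndex (a n) (d n) i<
    ... | front {u} {y} u< y< = trans (A-entry₁₁ u< y< u< y<) (trans (cong (δ u u *_) (A-diag y<)) (ℤP.*-zeroʳ (δ u u)))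
    ... | back {u} {y} u< y<  = trans (A-entry₂₂ u< y< u< y<) (trans (cong (_* P̂ n y y) (δ-∸-self u<)) (ℤP.*-zeroˡ (P̂ n y y)))

    A-zeroOne′ : ∀ {i j} → i < a (suc n) → j < a (suc n) → IsZeroOne (Â (suc n) i j)
    A-zeroOne′ i< j< with blockIndex (a n) (d n) i< | blockIndex (a n) (d n) j<
    ... | front {u} u< y< | front {w} w< y′< = δ-scaled-zeroOne u w (A-entry₁₁ u< y< w< y′<) (A-zeroOne y< y′<)
    ... | front {u} u< y< | back {w} w< y′<  = δ-scaled-zeroOne u w (A-entry₁₂ u< y< w< y′<) (B-zeroOne y< y′<)
    ... | back {u} u< y<  | front {w} w< y′< = δ-scaled-zeroOne (1 ∸ u) w (A-entry₂₁ u< y< w< y′<) (C-zeroOne y< y′<)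
    ... | back {u} u< y<  | back {w} w< y′<  = δ-scaled-zeroOne (1 ∸ u) w (A-entry₂₂ u< y< w< y′<) (P-zeroOne n y< y′<)

    C-zeroOne′ : ∀ {i j} → i < d (suc n) → j < a (suc n) → IsZeroOne (Ĉ (suc n) i j)
    C-zeroOne′ i< j< with C-rowIndex i< | blockIndex (a n) (d n) j<
    ... | triple {y = q} p< q< r< | front {w} w< y′< = δ-scaled-zeroOne q w (C-entry₁ p< q< r< w< y′<) (C-zeroOne (r<d r<) y′<)
    ... | triple {y = q} p< q< r< | back {w} w< y′<  = δ-scaled-zeroOne q w (C-entry₂ p< q< r< w< y′<) (P-zeroOne n (r<d r<) y′<)

    L-suc : L (suc n) ≡ L n ℕ.* 2
    L-suc = regroup (N n) t
      where regroup : ∀ x t → (2 ℕ.* x) ℕ.* t ≡ (x ℕ.* t) ℕ.* 2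
            regroup = solve-∀

    B-rows-lift : ∀ {i c y} (X : ℕ → ℕ → ℤ) → c < 2 → BlockIndicatorRow X (N n) (L n) y →
      (∀ {x y′ z} → x < 2 → y′ < d n → z < 2 →
         B̂ (suc n) i ((x ℕ.* d n ℕ.+ y′) ℕ.* 2 ℕ.+ z) ≡ δ c x * X y y′) →
      BlockIndicatorRow (B̂ (suc n)) (N (suc n)) (L (suc n)) i
    B-rows-lift {i} {c} {y} X c< (b , b< , row) entry =
      c ℕ.* N n ℕ.+ b , <-⊗ c< b< ,
      λ {β′} {γ′} β′< γ′< → lifted (productIndex {2} {N n} β′<) (productIndex {L n} {2} (subst (γ′ <_) L-suc γ′<))
      where
        lifted : ∀ {β′ γ′} → ProductIndex 2 (N n) β′ → ProductIndex (L n) 2 γ′ →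
                 B̂ (suc n) i (β′ ℕ.* L (suc n) ℕ.+ γ′) ≡ δ β′ (c ℕ.* N n ℕ.+ b)
        lifted (pair {x} {β} x< β<) (pair {g} {z} g< z<) = begin
          B̂ (suc n) i ((x ℕ.* N n ℕ.+ β) ℕ.* L (suc n) ℕ.+ (g ℕ.* 2 ℕ.+ z))
            ≡⟨ cong (B̂ (suc n) i) (reindex x (N n) t β g z) ⟩
          B̂ (suc n) i ((x ℕ.* d n ℕ.+ (β ℕ.* L n ℕ.+ g)) ℕ.* 2 ℕ.+ z)
            ≡⟨ entry x< (subst (β ℕ.* L n ℕ.+ g <_) (sym (dP≡N*L n)) (<-⊗ β< g<)) z< ⟩
          δ c x * X y (β ℕ.* L n ℕ.+ g)
            ≡⟨ cong₂ _*_ (δ-sym c x) (row β< g<) ⟩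
          δ x c * δ β b
            ≡⟨ sym (δ-⊗ x c β< b<) ⟩
          δ (x ℕ.* N n ℕ.+ β) (c ℕ.* N n ℕ.+ b) ∎
          where
            open ≡-Reasoning
            reindex : ∀ x N t β g z → (x ℕ.* N ℕ.+ β) ℕ.* ((2 ℕ.* N) ℕ.* t) ℕ.+ (g ℕ.* 2 ℕ.+ z)
                                    ≡ (x ℕ.* ((N ℕ.* N) ℕ.* t) ℕ.+ (β ℕ.* (N ℕ.* t) ℕ.+ g)) ℕ.* 2 ℕ.+ z
            reindex = solve-∀

    B-rows′ : ∀ {i} → i < a (suc n) → BlockIndicatorRow (B̂ (suc n)) (N (suc n)) (L (suc n)) i
    B-rows′ i< with blockIndex (a n) (d n) i<
    ... | front {u} {y} u< y< = B-rows-lift (B̂ n) (1∸-<2 u) (B-rows y<)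
      (λ {x} {y′} x< y′< z< → trans (B-entry₁ u< y< x< y′< z<) (cong (_* B̂ n y y′) (sym (δ-flip u< x<))))
    ... | back {u} {y} u< y< = B-rows-lift (P̂ n) u< (P-row-indicator n y<)
      (λ {x} {y′} x< y′< z< → trans (B-entry₂ u< y< x< y′< z<) (cong (_* P̂ n y y′) (sym (δ-∸∸ u< x<))))

    -- The rows of C_{n+1} repeat the first 2^n t rows of C_n and P_n (those kept by α),
    -- so only the balance of the first block of each column is used.
    C-cols-lift : ∀ {j b w y′} (X : ℕ → ℕ → ℤ) → w < 2 → BalancedColumn X (N n) (L n) t y′ →
      (∀ {q r} → q < 2 → r < L n → Ĉ (suc n) ((b ℕ.* 2 ℕ.+ q) ℕ.* L n ℕ.+ r) j ≡ δ q w * X r y′) →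
      ∑[ γ < L (suc n) ] Ĉ (suc n) (b ℕ.* L (suc n) ℕ.+ γ) j ≡ + t
    C-cols-lift {j} {b} {w} {y′} X w< balanced entry = begin
      ∑[ γ < L (suc n) ] Ĉ (suc n) (b ℕ.* L (suc n) ℕ.+ γ) j
        ≡⟨ cong (λ l → ∑[ γ < l ] Ĉ (suc n) (b ℕ.* L (suc n) ℕ.+ γ) j) (trans L-suc (ℕP.*-comm (L n) 2)) ⟩
      ∑[ γ < 2 ℕ.* L n ] Ĉ (suc n) (b ℕ.* L (suc n) ℕ.+ γ) j
        ≡⟨ ∑-⊗ 2 (L n) (λ q → δ q w) (λ r → X r y′)
               (λ q r q< r< → trans (cong (λ i → Ĉ (suc n) i j) (reindex b (N n) t q r)) (entry q< r<)) ⟩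
      (∑[ q < 2 ] δ q w) * (∑[ r < L n ] X r y′)
        ≡⟨ cong₂ _*_ (∑₂-δˡ w<) (balanced (1≤2^ n)) ⟩
      + 1 * + t
        ≡⟨ ℤP.*-identityˡ (+ t) ⟩
      + t ∎
      where
        open ≡-Reasoning
        reindex : ∀ b N t q r → b ℕ.* ((2 ℕ.* N) ℕ.* t) ℕ.+ (q ℕ.* (N ℕ.* t) ℕ.+ r)
                              ≡ (b ℕ.* 2 ℕ.+ q) ℕ.* (N ℕ.* t) ℕ.+ r
        reindex = solve-∀

    C-cols′ : ∀ {j} → j < a (suc n) → BalancedColumn (Ĉ (suc n)) (N (suc n)) (L (suc n)) t j
    C-cols′ j< {b} b< with blockIndex (a n) (d n) j<
    ... | front w< y′< = C-cols-lift {b = b} (Ĉ n) w< (C-cols y′<) (λ q< r< → C-entry₁ b< q< r< w< y′<)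
    ... | back w< y′<  = C-cols-lift {b = b} (P̂ n) w< (P-col-balanced n y′<) (λ q< r< → C-entry₂ b< q< r< w< y′<)

    step : Invariant (suc n)
    step = record
      { A-zeroOne = A-zeroOne′ ; C-zeroOne = C-zeroOne′ ; A-diag = A-diag′
      ; A-rowSum = A-rowSum′ ; A-colSum = A-colSum′ ; B-colSum = B-colSum′ ; C-rowSum = C-rowSum′
      ; B-rows = B-rows′ ; C-cols = C-cols′
      ; AA-law = AA-law′ ; AB-law = AB-law′ ; CA-law = CA-law′ ; CB-law = CB-law′ }

  opaque
    unfolding Â

    invariant-SRD : ∀ {n v′} → Invariant n → a n ≡ v′ → IsSRD (A n) v′ (k′ n) (+ t) lm (+ t)
    invariant-SRD {n} inv order =
      order ,
      (λ i j → subst IsZeroOne (extend-toℕ (A n) i j) (A-zeroOne (FinP.toℕ<n i) (FinP.toℕ<n j))) ,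
      (λ i → trans (sym (extend-toℕ (A n) i i)) (A-diag (FinP.toℕ<n i))) ,
      law-srd {t = + t} {lm = lm} AA-law ,
      ⊛J-from-rowSums A-rowSum ,
      J⊛-from-colSums A-colSum
      where
        open Invariant inv

  order : ∀ m → a (suc m) ≡ (v ℕ.+ (2 ^ (suc m ℕ.+ 1) ∸ 4) ℕ.* t) ℕ.* 2 ^ m
  order m = trans (closed m) (cong (λ e → (v ℕ.+ (2 ℕ.* 2 ^ e ∸ 4) ℕ.* t) ℕ.* 2 ^ m) (ℕP.+-comm 1 m))
    where
      closed : ∀ m → a (suc m) ≡ (v ℕ.+ (2 ℕ.* (2 ℕ.* 2 ^ m) ∸ 4) ℕ.* t) ℕ.* 2 ^ m
      closed zero    = sym (trans (ℕP.*-identityʳ _) (ℕP.+-identityʳ v))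
      closed (suc m) = trans (cong (λ x → 2 ℕ.* x ℕ.+ 2 ℕ.* d (suc m)) (closed m)) (doubling (2 ^ m) (1≤2^ m))
        where
          doubling : ∀ w → 1 ≤ w →
            2 ℕ.* ((v ℕ.+ (2 ℕ.* (2 ℕ.* w) ∸ 4) ℕ.* t) ℕ.* w) ℕ.+ 2 ℕ.* (((2 ℕ.* w) ℕ.* (2 ℕ.* w)) ℕ.* t)
              ≡ (v ℕ.+ (2 ℕ.* (2 ℕ.* (2 ℕ.* w)) ∸ 4) ℕ.* t) ℕ.* (2 ℕ.* w)
          doubling (suc y) _ = begin
            2 ℕ.* ((v ℕ.+ (2 ℕ.* (2 ℕ.* suc y) ∸ 4) ℕ.* t) ℕ.* suc y) ℕ.+ 2 ℕ.* (((2 ℕ.* suc y) ℕ.* (2 ℕ.* suc y)) ℕ.* t)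
              ≡⟨ cong (λ p → 2 ℕ.* ((v ℕ.+ p ℕ.* t) ℕ.* suc y) ℕ.+ 2 ℕ.* (((2 ℕ.* suc y) ℕ.* (2 ℕ.* suc y)) ℕ.* t)) (four y) ⟩
            2 ℕ.* ((v ℕ.+ (4 ℕ.* y) ℕ.* t) ℕ.* suc y) ℕ.+ 2 ℕ.* (((2 ℕ.* suc y) ℕ.* (2 ℕ.* suc y)) ℕ.* t)
              ≡⟨ poly v y t ⟩
            (v ℕ.+ (4 ℕ.+ 8 ℕ.* y) ℕ.* t) ℕ.* (2 ℕ.* suc y)
              ≡⟨ cong (λ q → (v ℕ.+ q ℕ.* t) ℕ.* (2 ℕ.* suc y)) (sym (eight y)) ⟩
            (v ℕ.+ (2 ℕ.* (2 ℕ.* (2 ℕ.* suc y)) ∸ 4) ℕ.* t) ℕ.* (2 ℕ.* suc y) ∎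
            where
              open ≡-Reasoning
              four : ∀ y → 2 ℕ.* (2 ℕ.* suc y) ∸ 4 ≡ 4 ℕ.* y
              four y = trans (cong (_∸ 4) (expand y)) (ℕP.m+n∸m≡n 4 (4 ℕ.* y))
                where expand : ∀ y → 2 ℕ.* (2 ℕ.* suc y) ≡ 4 ℕ.+ 4 ℕ.* y
                      expand = solve-∀
              eight : ∀ y → 2 ℕ.* (2 ℕ.* (2 ℕ.* suc y)) ∸ 4 ≡ 4 ℕ.+ 8 ℕ.* y
              eight y = trans (cong (_∸ 4) (expand y)) (ℕP.m+n∸m≡n 4 (4 ℕ.+ 8 ℕ.* y))
                where expand : ∀ y → 2 ℕ.* (2 ℕ.* (2 ℕ.* suc y)) ≡ 4 ℕ.+ (4 ℕ.+ 8 ℕ.* y)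
                      expand = solve-∀
              poly : ∀ v y t → 2 ℕ.* ((v ℕ.+ (4 ℕ.* y) ℕ.* t) ℕ.* suc y) ℕ.+ 2 ℕ.* (((2 ℕ.* suc y) ℕ.* (2 ℕ.* suc y)) ℕ.* t)
                               ≡ (v ℕ.+ (4 ℕ.+ 8 ℕ.* y) ℕ.* t) ℕ.* (2 ℕ.* suc y)
              poly = solve-∀

  module Initial
    (A-01 : ZeroOne A₁) (A-diag₁ : ∀ i → A₁ i i ≡ + 0) (A²≋ : A₁ ⊛ A₁ ≋ SRD-rhs A₁ (+ t) lm)
    (AJ≋ : A₁ ⊛ J v v ≋ k · J v v) (JA≋ : J v v ⊛ A₁ ≋ k · J v v)
    (B₁-01 : ZeroOne B₁) (C₁-01 : ZeroOne C₁)
    (AB≋ : A₁ ⊛ B₁ ⊕ (+ t - lm) · B₁ ≋ (+ t) · J v (4 ℕ.* t))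
    (CA≋ : C₁ ⊛ A₁ ⊕ (+ t - lm) · C₁ ≋ (+ t) · J (4 ℕ.* t) v)
    (CB≋ : C₁ ⊛ B₁ ⊕ (+ t - lm) · PP t 1 ≋ (+ t) · J (4 ℕ.* t) (4 ℕ.* t))
    (JB≋ : J v v ⊛ B₁ ≋ k · J v (4 ℕ.* t))
    (CJ≋ : C₁ ⊛ J v v ≋ k · J (4 ℕ.* t) v)
    (rows : RowBlocky t B₁) (cols : ColBalanced t C₁) (1≤t : 1 ≤ t) where

    0<2t : 0 < 2 ℕ.* t
    0<2t = ℕP.<-≤-trans 1≤t (ℕP.m≤m+n t (t ℕ.+ 0))

    4t≡2t+2t : 4 ℕ.* t ≡ 2 ℕ.* t ℕ.+ 2 ℕ.* t
    4t≡2t+2t = double t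
      where double : ∀ t → 4 ℕ.* t ≡ 2 ℕ.* t ℕ.+ 2 ℕ.* t
            double = solve-∀

    0<4t : 0 < 4 ℕ.* t
    0<4t = subst (0 <_) (sym 4t≡2t+2t) (ℕP.<-≤-trans 0<2t (ℕP.m≤m+n _ _))

    -- For v = 0 the identity C₁B₁ + sP₁ = tJ would read s · P₁(0,0) = t, but P₁(0,0) = 0 and t ≥ 1.
    0<v : 0 < v
    0<v = ℕP.n≢0⇒n>0 λ v≡0 → ℕP.<⇒≢ 1≤t (ℤP.+-injective (begin
      + 0                                                 ≡⟨ sym (ℤP.*-zeroʳ s) ⟩
      s * + 0                                             ≡⟨ cong (s *_) (sym P₁₀₀) ⟩
      s * P₁ 0 0                                          ≡⟨ sym (ℤP.+-identityˡ _) ⟩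
      + 0 + s * P₁ 0 0                                    ≡⟨ cong (_+ s * P₁ 0 0) (sym (cong (λ n → ∑[ h < n ] Ĉ₁ 0 h * B̂₁ h 0) v≡0)) ⟩
      (∑[ h < v ] Ĉ₁ 0 h * B̂₁ h 0) + s * P₁ 0 0         ≡⟨ law-entry {X = C₁} {Y = B₁} 0<4t 0<4t {Z = PP t 1} {c = s} CB≋ ⟩
      + t                                                 ∎))
      where
        open ≡-Reasoning
        Ĉ₁ B̂₁ P₁ : ℕ → ℕ → ℤ
        Ĉ₁ = extend C₁
        B̂₁ = extend B₁
        P₁ = extend (PP t 1)
        P₁₀₀ : P₁ 0 0 ≡ + 0
        P₁₀₀ = trans (sym (P̂-extend 1 0 0)) (P-entry 1 {0} {0} {0} {0} {0} (s≤s z≤n) (s≤s z≤n) 1≤t (s≤s z≤n) 0<2t)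

    B₁-row : ∀ {i} (i< : i < v) {b} → b < 2 →
      (∀ j → toℕ j < 2 ℕ.* t → B₁ (fromℕ< i<) j ≡ δ 0 b) →
      (∀ j → 2 ℕ.* t ≤ toℕ j → B₁ (fromℕ< i<) j ≡ δ 1 b) →
      BlockIndicatorRow (extend B₁) 2 (2 ℕ.* t) i
    B₁-row {i} i< {b} b< low high = b , b< , λ {β} {γ} β< γ< →
      bit-elim (λ β → extend B₁ i (β ℕ.* (2 ℕ.* t) ℕ.+ γ) ≡ δ β b) (first-half γ<) (second-half γ<) β<
      where
        entry : ∀ {l} (l< : l < 4 ℕ.* t) → extend B₁ i l ≡ B₁ (fromℕ< i<) (fromℕ< l<)
        entry = extend-fromℕ< B₁ i<
        first-half : ∀ {γ} → γ < 2 ℕ.* t → extend B₁ i γ ≡ δ 0 b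
        first-half {γ} γ< = trans (entry γ<4t) (low _ (subst (_< 2 ℕ.* t) (sym (FinP.toℕ-fromℕ< γ<4t)) γ<))
          where
            γ<4t : γ < 4 ℕ.* t
            γ<4t = subst (γ <_) (sym 4t≡2t+2t) (ℕP.<-≤-trans γ< (ℕP.m≤m+n _ _))
        second-half : ∀ {γ} → γ < 2 ℕ.* t → extend B₁ i (1 ℕ.* (2 ℕ.* t) ℕ.+ γ) ≡ δ 1 b
        second-half {γ} γ< = trans (entry l<4t) (high _ (subst (2 ℕ.* t ≤_) (sym (FinP.toℕ-fromℕ< l<4t)) 2t≤l))
          where
            l≡ : 1 ℕ.* (2 ℕ.* t) ℕ.+ γ ≡ 2 ℕ.* t ℕ.+ γ
            l≡ = cong (ℕ._+ γ) (ℕP.*-identityˡ (2 ℕ.* t))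
            l<4t : 1 ℕ.* (2 ℕ.* t) ℕ.+ γ < 4 ℕ.* t
            l<4t = subst₂ _<_ (sym l≡) (sym 4t≡2t+2t) (ℕP.+-monoʳ-< (2 ℕ.* t) γ<)
            2t≤l : 2 ℕ.* t ≤ 1 ℕ.* (2 ℕ.* t) ℕ.+ γ
            2t≤l = subst (2 ℕ.* t ≤_) (sym l≡) (ℕP.m≤m+n (2 ℕ.* t) γ)

    column-count : ∀ {j} (j< : j < v) (p : ℕ → Bool) →
      + count (λ i → p (toℕ i) ∧ ⌊ C₁ i (fromℕ< j<) ℤ.≟ + 1 ⌋)
        ≡ ∑[ l < 2 ℕ.* t ℕ.+ 2 ℕ.* t ] (if p l then extend C₁ l j else + 0)
    column-count {j} j< p = begin
      + count (λ i → p (toℕ i) ∧ ⌊ C₁ i (fromℕ< j<) ℤ.≟ + 1 ⌋)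
        ≡⟨ count-∑ (λ i → p (toℕ i)) (λ i → C₁ i (fromℕ< j<)) (λ i → C₁-01 i (fromℕ< j<)) ⟩
      sumF {4 ℕ.* t} (λ i → if p (toℕ i) then C₁ i (fromℕ< j<) else + 0)
        ≡⟨ sumF-cong {4 ℕ.* t} (λ i → cong (λ c → if p (toℕ i) then c else + 0) (sym (entry i))) ⟩
      sumF {4 ℕ.* t} (λ i → if p (toℕ i) then extend C₁ (toℕ i) j else + 0)
        ≡⟨ sumF-toℕ {4 ℕ.* t} (λ l → if p l then extend C₁ l j else + 0) ⟩
      ∑[ l < 4 ℕ.* t ] (if p l then extend C₁ l j else + 0)
        ≡⟨ cong (λ n → ∑[ l < n ] (if p l then extend C₁ l j else + 0)) 4t≡2t+2t ⟩
      ∑[ l < 2 ℕ.* t ℕ.+ 2 ℕ.* t ] (if p l then extend C₁ l j else + 0) ∎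
      where
        open ≡-Reasoning
        entry : ∀ i → extend C₁ (toℕ i) j ≡ C₁ i (fromℕ< j<)
        entry i = trans (extend-fromℕ< C₁ (FinP.toℕ<n i) j<) (cong (λ r → C₁ r _) (FinP.fromℕ<-toℕ i _))

    C₁-col : ∀ {j} → j < v → BalancedColumn (extend C₁) 2 (2 ℕ.* t) t j
    C₁-col {j} j< {b} b< =
      bit-elim (λ b → ∑[ γ < 2 ℕ.* t ] extend C₁ (b ℕ.* (2 ℕ.* t) ℕ.+ γ) j ≡ + t) first-half second-half b<
      where
        open ≡-Reasoning
        first-half : ∑[ γ < 2 ℕ.* t ] extend C₁ γ j ≡ + t
        first-half = begin
          ∑[ γ < 2 ℕ.* t ] extend C₁ γ j
            ≡⟨ sym (∑-below (2 ℕ.* t) (2 ℕ.* t) (λ l → extend C₁ l j)) ⟩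
          ∑[ l < 2 ℕ.* t ℕ.+ 2 ℕ.* t ] (if ⌊ l <? 2 ℕ.* t ⌋ then extend C₁ l j else + 0)
            ≡⟨ sym (column-count j< (λ l → ⌊ l <? 2 ℕ.* t ⌋)) ⟩
          + count (λ i → ⌊ toℕ i <? 2 ℕ.* t ⌋ ∧ ⌊ C₁ i (fromℕ< j<) ℤ.≟ + 1 ⌋)
            ≡⟨ cong +_ (proj₁ (cols (fromℕ< j<))) ⟩
          + t ∎
        second-half : ∑[ γ < 2 ℕ.* t ] extend C₁ (1 ℕ.* (2 ℕ.* t) ℕ.+ γ) j ≡ + t
        second-half = begin
          ∑[ γ < 2 ℕ.* t ] extend C₁ (1 ℕ.* (2 ℕ.* t) ℕ.+ γ) j
            ≡⟨ ∑-cong (2 ℕ.* t) (λ γ _ → cong (λ r → extend C₁ (r ℕ.+ γ) j) (ℕP.*-identityˡ (2 ℕ.* t))) ⟩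
          ∑[ γ < 2 ℕ.* t ] extend C₁ (2 ℕ.* t ℕ.+ γ) j
            ≡⟨ sym (∑-above (2 ℕ.* t) (2 ℕ.* t) (λ l → extend C₁ l j)) ⟩
          ∑[ l < 2 ℕ.* t ℕ.+ 2 ℕ.* t ] (if not ⌊ l <? 2 ℕ.* t ⌋ then extend C₁ l j else + 0)
            ≡⟨ sym (column-count j< (λ l → not ⌊ l <? 2 ℕ.* t ⌋)) ⟩
          + count (λ i → not ⌊ toℕ i <? 2 ℕ.* t ⌋ ∧ ⌊ C₁ i (fromℕ< j<) ℤ.≟ + 1 ⌋)
            ≡⟨ cong +_ (proj₂ (cols (fromℕ< j<))) ⟩
          + t ∎

    B₁-rows : ∀ {i} → i < v → BlockIndicatorRow (extend B₁) 2 (2 ℕ.* t) i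
    B₁-rows i< with rows (fromℕ< i<)
    ... | inj₁ (ones , zeros) = B₁-row i< (s≤s z≤n) ones zeros
    ... | inj₂ (zeros , ones) = B₁-row i< (s≤s (s≤s z≤n)) zeros ones

    opaque
      unfolding Â B̂ Ĉ P̂

      base : Invariant 1
      base = record
        { A-zeroOne = extend-zeroOne A-01
        ; C-zeroOne = extend-zeroOne C₁-01
        ; A-diag    = λ i< → trans (extend-fromℕ< A₁ i< i<) (A-diag₁ _)
        ; A-rowSum  = λ i< → trans (row-sum-entry AJ≋ i< 0<v) (sym (ℤP.+-identityʳ k))
        ; A-colSum  = λ j< → trans (col-sum-entry JA≋ j< 0<v) (sym (ℤP.+-identityʳ k))
        ; B-colSum  = λ j< → trans (col-sum-entry JB≋ j< 0<v) (sym (ℤP.+-identityʳ k))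
        ; C-rowSum  = λ i< → trans (row-sum-entry CJ≋ i< 0<v) (sym (ℤP.+-identityʳ k))
        ; B-rows    = B₁-rows
        ; C-cols    = C₁-col
        ; AA-law    = srd-law {t = + t} {lm = lm} A²≋
        ; AB-law    = λ i< j< → law-entry {X = A₁} {Y = B₁} i< j< {Z = B₁} {c = s} AB≋
        ; CA-law    = λ i< j< → law-entry {X = C₁} {Y = A₁} i< j< {Z = C₁} {c = s} CA≋
        ; CB-law    = λ i< j< → law-entry {X = C₁} {Y = B₁} i< j< {Z = PP t 1} {c = s} CB≋
        }

    invariant : ∀ m → Invariant (suc m)
    invariant zero    = base
    invariant (suc m) = Step.step m (invariant m)

theorem1 : (v t : ℕ) (k lm : ℤ) → 1 ≤ t
    → (A₁ : Mat v v) → IsSRD A₁ v k (+ t) lm (+ t)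
    → (B₁ : Mat v (4 ℕ.* t)) (C₁ : Mat (4 ℕ.* t) v)
    → ZeroOne B₁ → ZeroOne C₁
    → B₁ ⊛ C₁ ≋ (+ t) · J v v
    → B₁ ⊛ PP t 1 ≋ (+ t) · J v (4 ℕ.* t)
    → PP t 1 ⊛ C₁ ≋ (+ t) · J (4 ℕ.* t) v
    → A₁ ⊛ B₁ ⊕ (+ t - lm) · B₁ ≋ (+ t) · J v (4 ℕ.* t)
    → C₁ ⊛ A₁ ⊕ (+ t - lm) · C₁ ≋ (+ t) · J (4 ℕ.* t) v
    → C₁ ⊛ B₁ ⊕ (+ t - lm) · PP t 1 ≋ (+ t) · J (4 ℕ.* t) (4 ℕ.* t)
    → B₁ ⊛ J (4 ℕ.* t) (4 ℕ.* t) ≋ (+ (2 ℕ.* t)) · J v (4 ℕ.* t)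
    → J v v ⊛ B₁ ≋ k · J v (4 ℕ.* t)
    → C₁ ⊛ J v v ≋ k · J (4 ℕ.* t) v
    → J (4 ℕ.* t) (4 ℕ.* t) ⊛ C₁ ≋ (+ (2 ℕ.* t)) · J (4 ℕ.* t) v
    → RowBlocky t B₁
    → ColBalanced t C₁
    → ∀ n → 1 ≤ n
    → IsSRD (Construction.A v t A₁ B₁ C₁ n)
            ((v ℕ.+ (2 ^ (n ℕ.+ 1) ∸ 4) ℕ.* t) ℕ.* 2 ^ (n ∸ 1))
            (k + + ((2 ^ n ∸ 2) ℕ.* t))
            (+ t) lm (+ t)
theorem1 v t k lm 1≤t A₁ (_ , A-01 , A-diag , A²≋ , AJ≋ , JA≋) B₁ C₁ B₁-01 C₁-01 _ _ _ AB≋ CA≋ CB≋ _ JB≋ CJ≋ _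
         rows cols (suc m) _ = invariant-SRD (invariant m) (order m)
  where
    open Development v t k lm A₁ B₁ C₁
    open Initial A-01 A-diag A²≋ AJ≋ JA≋ B₁-01 C₁-01 AB≋ CA≋ CB≋ JB≋ CJ≋ rows cols 1≤t
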